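{- Let $p>2$ be a prime and let $\alpha\in\mathbb{Q}_p$ be a quadratic irrational over $\mathbb{Q}$ with $v_p(\alpha)<0$ and $v_p(\alpha^c)>0$. Let $\alpha=[a_0,a_1,\dots]$ be its Browkin continued fraction expansion with complete quotients $\alpha_n$. Then for every $n\ge0$: (a) $v_p(\alpha_n)<0$ and $v_p(\alpha_n^c)>0$; (b) $-\frac{1}{\alpha_{n+1}^c}=\left[a_n,a_{n-1},\dots,a_0,-\frac{1}{\alpha_0^c}\right]$, i.e. $-\frac{1}{\alpha_{n+1}^c}=a_n+\cfrac{1}{a_{n-1}+\cfrac{1}{\ddots+\cfrac{1}{a_0+\cfrac{1}{ -1/\alpha_0^c}}}}$.
   Context: Let $\mathcal{Y}=\mathbb{Z}[1/p]\cap(-p/2,p/2)$; for $\gamma\in\mathbb{Q}_p$, $s(\gamma)$ is the unique element of $\mathcal{Y}$ with $|\gamma-s(\gamma)|_p<1$. The Browkin continued fraction of $\alpha$ is obtained by $\alpha_0=\alpha$, $a_n=s(\alpha_n)$, $\alpha_{n+1}=1/(\alpha_n-a_n)$; the $a_n$ are partial quotients and the $\alpha_n$ complete quotients (for a quadratic irrational the process never stops, and all $\alpha_n$ lie in $\mathbb{Q}(\alpha)\subset\mathbb{Q}_p$). For $x\in\mathbb{Q}(\alpha)$, $x^c$ denotes its conjugate under the nontrivial automorphism of $\mathbb{Q}(\alpha)$ (so $x^c\in\mathbb{Q}_p$). -}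

module Defs where

open import Data.Nat as ℕ using (ℕ; zero; suc; NonZero)
open import Data.Nat.Properties using (m^n≢0)
open import Data.Integer as ℤ using (ℤ; +_; -[1+_])
open import Data.Rational using (ℚ; ↥_; ↧ₙ_)
open import Data.List using (List; []; _∷_)
open import Relation.Binary.PropositionalEquality using (_≡_)
open import Relation.Nullary using (¬_)

module Padic (p : ℕ) {{p≢0 : NonZero p}} where

  -- Elements of ℤ_p as digit sequences: digit i is (d i % p); the element is Σ (d i % p) p^i.
  -- Every function ℕ → ℕ is a valid p-adic integer.
  record ℤp : Set where
    constructor mkℤp
    field digit : ℕ → ℕ
  open ℤp public

  dig : ℤp → ℕ → ℕ
  dig x i = digit x i ℕ.% p

  val : ℕ → ℤp → ℕ
  val zero    x = 0
  val (suc k) x = val k x ℕ.+ dig x k ℕ.* p ℕ.^ k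

  digitOf : ℕ → ℕ → ℕ
  digitOf n i = (ℕ._/_ n (p ℕ.^ i) {{m^n≢0 p i}}) ℕ.% p

  _≈ℤp_ : ℤp → ℤp → Set
  x ≈ℤp y = ∀ i → dig x i ≡ dig y i

  ofℕℤp : ℕ → ℤp
  ofℕℤp n = mkℤp (digitOf n)

  addℤp : ℤp → ℤp → ℤp
  addℤp x y = mkℤp (λ i → digitOf (val (suc i) x ℕ.+ val (suc i) y) i)

  mulℤp : ℤp → ℤp → ℤp
  mulℤp x y = mkℤp (λ i → digitOf (val (suc i) x ℕ.* val (suc i) y) i)

  negℤp : ℤp → ℤp
  negℤp x = mkℤp (λ i → digitOf (p ℕ.^ suc i ℕ.∸ val (suc i) x) i)

  ofℤℤp : ℤ → ℤp
  ofℤℤp (+ n)    = ofℕℤp n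
  ofℤℤp -[1+ n ] = negℤp (ofℕℤp (suc n))

  -- ℚ_p: the pair (e , u) denotes p^(-e) · u
  record Qp : Set where
    constructor mkQp
    field
      expo : ℕ
      unit : ℤp
  open Qp public

  infix  4 _≈_
  infixl 6 _+_ _-_
  infixl 7 _*_

  _≈_ : Qp → Qp → Set
  mkQp e u ≈ mkQp e' u' = mulℤp (ofℕℤp (p ℕ.^ e')) u ≈ℤp mulℤp (ofℕℤp (p ℕ.^ e)) u'

  _+_ : Qp → Qp → Qp
  mkQp e u + mkQp e' u' =
    mkQp (e ℕ.+ e') (addℤp (mulℤp (ofℕℤp (p ℕ.^ e')) u) (mulℤp (ofℕℤp (p ℕ.^ e)) u'))

  _*_ : Qp → Qp → Qp
  mkQp e u * mkQp e' u' = mkQp (e ℕ.+ e') (mulℤp u u')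

  -_ : Qp → Qp
  - mkQp e u = mkQp e (negℤp u)

  _-_ : Qp → Qp → Qp
  x - y = x + (- y)

  ofℤ : ℤ → Qp
  ofℤ n = mkQp 0 (ofℤℤp n)

  0ₚ 1ₚ : Qp
  0ₚ = ofℤ (+ 0)
  1ₚ = ofℤ (+ 1)

  ofℤ[1/p] : ℤ → ℕ → Qp
  ofℤ[1/p] N e = mkQp e (ofℤℤp N)

  Rep : ℚ → Qp → Set
  Rep r z = ofℤ (↥ r) ≈ ofℤ (+ (↧ₙ r)) * z

  -- v_p(z) ≥ 0, i.e. z ∈ ℤ_p  (p^e divides u)
  InZp : Qp → Set
  InZp (mkQp e u) = val e u ≡ 0

  InpZp : Qp → Set
  InpZp (mkQp e u) = val (suc e) u ≡ 0

  NegVal : Qp → Set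
  NegVal z = ¬ InZp z

  -- CFEval [a_n, …, a_0] β γ : the finite continued fraction [a_n, …, a_0, β]
  -- is defined (all denominators nonzero) and has value γ.
  data CFEval : List Qp → Qp → Qp → Set where
    cf-base : ∀ {β γ} → γ ≈ β → CFEval [] β γ
    cf-step : ∀ {a as β δ w γ} → CFEval as β δ → w * δ ≈ 1ₚ → γ ≈ a + w →
              CFEval (a ∷ as) β γ

downFrom : {A : Set} → (ℕ → A) → ℕ → List A
downFrom f zero    = f zero ∷ []
downFrom f (suc n) = f (suc n) ∷ downFrom f n

{-# OPTIONS --safe #-}
-- Write α_n = X_n + Y_n α with rational X_n, Y_n. Since α is irrational of degree two, the relation
-- α_{n+1}(α_n − a_n) = 1 between rational combinations of α is an identity modulo the minimal polynomial
-- t² + Bt + C, so it also holds at the other root αᶜ = −B − α: α_{n+1}ᶜ(α_nᶜ − a_n) = 1. Thus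
-- −1/α_{n+1}ᶜ = a_n + 1/(−1/α_nᶜ), which unrolls to the continued fraction (b). For (a), by induction:
-- |α_n| > 1 and |α_n − a_n| < 1 give |a_n| > 1, then |α_nᶜ| < 1 gives |α_nᶜ − a_n| > 1, whence
-- |α_{n+1}ᶜ| < 1, while |α_{n+1}| = 1/|α_n − a_n| > 1.
--
-- ℚ_p is given as digit sequences, so its arithmetic is obtained by comparing p-adic integers with
-- integers through their truncations modulo p^k: ring identities in ℚ_p are inherited from ring
-- identities in ℤ, and valuations are read off from divisibility of truncations by powers of p.
module Submission where

open import Defs
open import Level using (0ℓ)
open import Function using (_∘_)
open import Data.Empty using (⊥-elim)
open import Data.Sum using (inj₁; inj₂)
open import Data.Product using (_×_; _,_; ∃; Σ; proj₁; proj₂)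
open import Data.Maybe using (Maybe; just; nothing)
open import Data.Nat as ℕ using (ℕ; zero; suc; NonZero; z≤n; s≤s; _∸_)
import Data.Nat.Properties as ℕₚ
open import Data.Nat.Properties using (m^n≢0)
open import Data.Nat.DivMod
  using (_%_; _/_; m%n<n; m%n≤m; m<n⇒m%n≡m; [m+kn]%n≡m%n; m≡m%n+[m/n]*n; n%1≡0;
         m%[n*o]/o≡m/o%n; m%n%n≡m%n; %-distribˡ-+; %-distribˡ-*; %-remove-+ʳ)
import Data.Nat.Divisibility as ℕᵈ
open import Data.Nat.Primality using (Prime; euclidsLemma; prime⇒nonZero; prime⇒nonTrivial)
import Data.Nat.Tactic.RingSolver as ℕ-Solver
open import Data.Integer as ℤ using (ℤ; +_; -[1+_]; ∣_∣)
import Data.Integer.Properties as ℤₚ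
import Data.Integer.Divisibility.Signed as ℤᵈ
import Data.Integer.Tactic.RingSolver as ℤ-Solver
open import Data.Rational using (ℚ; mkℚ; fromℚᵘ; ↥_; ↧ₙ_)
open import Data.Rational.Properties using (toℚᵘ-fromℚᵘ)
open import Data.Rational.Unnormalised using (mkℚᵘ; *≡*)
open import Relation.Nullary using (¬_; Dec; yes; no)
import Relation.Nullary.Decidable as Dec
open import Relation.Binary.PropositionalEquality
open import Relation.Binary.Structures using (IsEquivalence)
open import Relation.Binary.Bundles using (Setoid)
import Relation.Binary.Reasoning.Setoid as ≈-Reasoning
open import Algebra.Structures using (IsCommutativeRing)
import Algebra.Consequences.Setoid
import Algebra.Solver.Ring
import Algebra.Solver.Ring.AlmostCommutativeRing as ACR

module Truncation (p : ℕ) {{_ : NonZero p}} where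
  open Padic p using (ℤp; digit; dig; val; digitOf; _≈ℤp_; ofℕℤp; addℤp; mulℤp; negℤp; ofℤℤp)

  infixl 7 _%p^_
  _%p^_ : ℕ → ℕ → ℕ
  m %p^ k = _%_ m (p ℕ.^ k) {{m^n≢0 p k}}

  m<n∧d<p⇒m+d*n<p*n : ∀ {m d n} → m ℕ.< n → d ℕ.< p → m ℕ.+ d ℕ.* n ℕ.< p ℕ.* n
  m<n∧d<p⇒m+d*n<p*n {m} {d} {n} m<n d<p =
    ℕₚ.≤-trans (ℕₚ.+-monoˡ-≤ (d ℕ.* n) m<n) (ℕₚ.*-monoˡ-≤ n d<p)

  val<p^ : ∀ k x → val k x ℕ.< p ℕ.^ k
  val<p^ zero    x = s≤s z≤n
  val<p^ (suc k) x = m<n∧d<p⇒m+d*n<p*n (val<p^ k x) (m%n<n (digit x k) p)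

  %p^-suc : ∀ m i → m %p^ suc i ≡ m %p^ i ℕ.+ digitOf m i ℕ.* p ℕ.^ i
  %p^-suc m i = begin
      m %p^ suc i                         ≡⟨ cong (_%p^ suc i) m≡r+q*p^[1+i] ⟩
      (r ℕ.+ q ℕ.* p ℕ.^ suc i) %p^ suc i ≡⟨ [m+kn]%n≡m%n r q (p ℕ.^ suc i) ⟩
      r %p^ suc i                         ≡⟨ m<n⇒m%n≡m r<p^[1+i] ⟩
      r                                   ∎
    where
    open ≡-Reasoning
    instance
      p^i≢0 : NonZero (p ℕ.^ i)
      p^i≢0 = m^n≢0 p i
      p^[1+i]≢0 : NonZero (p ℕ.^ suc i)
      p^[1+i]≢0 = m^n≢0 p (suc i)
    M = p ℕ.^ i
    r = m %p^ i ℕ.+ digitOf m i ℕ.* M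
    q = m / M / p
    r<p^[1+i] : r ℕ.< p ℕ.^ suc i
    r<p^[1+i] = m<n∧d<p⇒m+d*n<p*n (m%n<n m M) (m%n<n (m / M) p)
    regroup : ∀ a d q p M → a ℕ.+ (d ℕ.+ q ℕ.* p) ℕ.* M ≡ a ℕ.+ d ℕ.* M ℕ.+ q ℕ.* (p ℕ.* M)
    regroup = ℕ-Solver.solve-∀
    m≡r+q*p^[1+i] : m ≡ r ℕ.+ q ℕ.* p ℕ.^ suc i
    m≡r+q*p^[1+i] = begin
      m                                      ≡⟨ m≡m%n+[m/n]*n m M ⟩
      m %p^ i ℕ.+ m / M ℕ.* M                ≡⟨ cong (λ t → m %p^ i ℕ.+ t ℕ.* M) (m≡m%n+[m/n]*n (m / M) p) ⟩
      m %p^ i ℕ.+ (digitOf m i ℕ.+ q ℕ.* p) ℕ.* M ≡⟨ regroup (m %p^ i) (digitOf m i) q p M ⟩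
      r ℕ.+ q ℕ.* p ℕ.^ suc i                ∎

  val≡%p^ : ∀ k z m → (∀ i → i ℕ.< k → dig z i ≡ digitOf m i) → val k z ≡ m %p^ k
  val≡%p^ zero    z m _ = sym (n%1≡0 m)
  val≡%p^ (suc k) z m h = trans
    (cong₂ (λ a b → a ℕ.+ b ℕ.* p ℕ.^ k) (val≡%p^ k z m (λ i i<k → h i (ℕₚ.m<n⇒m<1+n i<k))) (h k ℕₚ.≤-refl))
    (sym (%p^-suc m k))

  digitOf-cong : ∀ m n i → m %p^ suc i ≡ n %p^ suc i → digitOf m i ≡ digitOf n i
  digitOf-cong m n i e = begin
      m / p ℕ.^ i % p                 ≡⟨ m%[n*o]/o≡m/o%n m p (p ℕ.^ i) ⟨
      m %p^ suc i / p ℕ.^ i           ≡⟨ cong (_/ p ℕ.^ i) e ⟩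
      n %p^ suc i / p ℕ.^ i           ≡⟨ m%[n*o]/o≡m/o%n n p (p ℕ.^ i) ⟩
      n / p ℕ.^ i % p                 ∎
    where
    open ≡-Reasoning
    instance
      p^i≢0 : NonZero (p ℕ.^ i)
      p^i≢0 = m^n≢0 p i
      p^[1+i]≢0 : NonZero (p ℕ.^ suc i)
      p^[1+i]≢0 = m^n≢0 p (suc i)

  val-+-%p^ : ∀ j k x → val (j ℕ.+ k) x %p^ k ≡ val k x
  val-+-%p^ zero    k x = m<n⇒m%n≡m {{m^n≢0 p k}} (val<p^ k x)
  val-+-%p^ (suc j) k x = begin
      (val (j ℕ.+ k) x ℕ.+ d ℕ.* p ℕ.^ (j ℕ.+ k)) %p^ k   ≡⟨ cong (λ t → (val (j ℕ.+ k) x ℕ.+ t) %p^ k) split ⟩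
      (val (j ℕ.+ k) x ℕ.+ d ℕ.* p ℕ.^ j ℕ.* p ℕ.^ k) %p^ k
        ≡⟨ [m+kn]%n≡m%n (val (j ℕ.+ k) x) (d ℕ.* p ℕ.^ j) (p ℕ.^ k) ⟩
      val (j ℕ.+ k) x %p^ k                                ≡⟨ val-+-%p^ j k x ⟩
      val k x                                              ∎
    where
    open ≡-Reasoning
    instance
      p^k≢0 : NonZero (p ℕ.^ k)
      p^k≢0 = m^n≢0 p k
    d = dig x (j ℕ.+ k)
    split : d ℕ.* p ℕ.^ (j ℕ.+ k) ≡ d ℕ.* p ℕ.^ j ℕ.* p ℕ.^ k
    split = trans (cong (d ℕ.*_) (ℕₚ.^-distribˡ-+-* p j k)) (sym (ℕₚ.*-assoc d _ _))

  val-%p^ : ∀ x {t k} → t ℕ.≤ k → val k x %p^ t ≡ val t x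
  val-%p^ x {t} t≤k =
    let j , t+j≡k = ℕₚ.m≤n⇒∃[o]m+o≡n t≤k in
    subst (λ n → val n x %p^ t ≡ val t x) (trans (ℕₚ.+-comm j t) t+j≡k) (val-+-%p^ j t x)

  +p^_ : ℕ → ℤ
  +p^ k = + (p ℕ.^ k)

  +val : ℕ → ℤp → ℤ
  +val k x = + val k x

  +p^-+ : ∀ a b → +p^ (a ℕ.+ b) ≡ +p^ a ℤ.* +p^ b
  +p^-+ a b = trans (cong +_ (ℕₚ.^-distribˡ-+-* p a b)) (ℤₚ.pos-* (p ℕ.^ a) (p ℕ.^ b))

  +∸≡- : ∀ {a b} → b ℕ.≤ a → + (a ∸ b) ≡ + a ℤ.- + b
  +∸≡- {a} {b} b≤a = sym (trans (ℤₚ.[+m]-[+n]≡m⊖n a b) (ℤₚ.≤-⊖ b≤a))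

  -- A record rather than a synonym, so that both sides and the exponent can be inferred.
  infix 4 _≡[mod-p^_]_
  record _≡[mod-p^_]_ (a : ℤ) (k : ℕ) (b : ℤ) : Set where
    constructor mod-p^
    field p^∣- : +p^ k ℤᵈ.∣ a ℤ.- b
  open _≡[mod-p^_]_ public

  module _ {k : ℕ} where

    ≡⇒≡ᵐ : ∀ {a b} → a ≡ b → a ≡[mod-p^ k ] b
    ≡⇒≡ᵐ {a} refl = mod-p^ (ℤᵈ.divides (+ 0) (ℤₚ.+-inverseʳ a))

    ≡ᵐ-refl : ∀ {a} → a ≡[mod-p^ k ] a
    ≡ᵐ-refl = ≡⇒≡ᵐ refl

    ≡ᵐ-sym : ∀ {a b} → a ≡[mod-p^ k ] b → b ≡[mod-p^ k ] a
    ≡ᵐ-sym {a} {b} (mod-p^ d) = mod-p^ (subst (+p^ k ℤᵈ.∣_) (negate a b) (ℤᵈ.∣m⇒∣-m d))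
      where
      negate : ∀ a b → ℤ.- (a ℤ.- b) ≡ b ℤ.- a
      negate = ℤ-Solver.solve-∀

    ≡ᵐ-trans : ∀ {a b c} → a ≡[mod-p^ k ] b → b ≡[mod-p^ k ] c → a ≡[mod-p^ k ] c
    ≡ᵐ-trans {a} {b} {c} (mod-p^ d) (mod-p^ e) = mod-p^ (subst (+p^ k ℤᵈ.∣_) (telescope a b c) (ℤᵈ.∣m∣n⇒∣m+n d e))
      where
      telescope : ∀ a b c → (a ℤ.- b) ℤ.+ (b ℤ.- c) ≡ a ℤ.- c
      telescope = ℤ-Solver.solve-∀

    ≡ᵐ-+-cong : ∀ {a b c d} → a ≡[mod-p^ k ] b → c ≡[mod-p^ k ] d → a ℤ.+ c ≡[mod-p^ k ] b ℤ.+ d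
    ≡ᵐ-+-cong {a} {b} {c} {d} (mod-p^ e) (mod-p^ f) =
      mod-p^ (subst (+p^ k ℤᵈ.∣_) (regroup a b c d) (ℤᵈ.∣m∣n⇒∣m+n e f))
      where
      regroup : ∀ a b c d → (a ℤ.- b) ℤ.+ (c ℤ.- d) ≡ (a ℤ.+ c) ℤ.- (b ℤ.+ d)
      regroup = ℤ-Solver.solve-∀

    ≡ᵐ-neg-cong : ∀ {a b} → a ≡[mod-p^ k ] b → ℤ.- a ≡[mod-p^ k ] ℤ.- b
    ≡ᵐ-neg-cong {a} {b} (mod-p^ e) = mod-p^ (subst (+p^ k ℤᵈ.∣_) (regroup a b) (ℤᵈ.∣m⇒∣-m e))
      where
      regroup : ∀ a b → ℤ.- (a ℤ.- b) ≡ ℤ.- a ℤ.- ℤ.- b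
      regroup = ℤ-Solver.solve-∀

    ≡ᵐ---cong : ∀ {a b c d} → a ≡[mod-p^ k ] b → c ≡[mod-p^ k ] d → a ℤ.- c ≡[mod-p^ k ] b ℤ.- d
    ≡ᵐ---cong e f = ≡ᵐ-+-cong e (≡ᵐ-neg-cong f)

    ≡ᵐ-*-cong : ∀ {a b c d} → a ≡[mod-p^ k ] b → c ≡[mod-p^ k ] d → a ℤ.* c ≡[mod-p^ k ] b ℤ.* d
    ≡ᵐ-*-cong {a} {b} {c} {d} (mod-p^ e) (mod-p^ f) =
      mod-p^ (subst (+p^ k ℤᵈ.∣_) (regroup a b c d) (ℤᵈ.∣m∣n⇒∣m+n (ℤᵈ.∣n⇒∣m*n c e) (ℤᵈ.∣n⇒∣m*n b f)))
      where
      regroup : ∀ a b c d → c ℤ.* (a ℤ.- b) ℤ.+ b ℤ.* (c ℤ.- d) ≡ a ℤ.* c ℤ.- b ℤ.* d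
      regroup = ℤ-Solver.solve-∀

    ≡ᵐ-*ˡ : ∀ c {a b} → a ≡[mod-p^ k ] b → c ℤ.* a ≡[mod-p^ k ] c ℤ.* b
    ≡ᵐ-*ˡ c = ≡ᵐ-*-cong (≡ᵐ-refl {c})

  ≡ᵐ-isEquivalence : ∀ k → IsEquivalence (λ a b → a ≡[mod-p^ k ] b)
  ≡ᵐ-isEquivalence k = record { refl = ≡ᵐ-refl ; sym = ≡ᵐ-sym ; trans = ≡ᵐ-trans }

  ≡ᵐ-setoid : ℕ → Setoid 0ℓ 0ℓ
  ≡ᵐ-setoid k = record { isEquivalence = ≡ᵐ-isEquivalence k }

  ≡ᵐ-weaken : ∀ {t k a b} → t ℕ.≤ k → a ≡[mod-p^ k ] b → a ≡[mod-p^ t ] b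
  ≡ᵐ-weaken {t} t≤k (mod-p^ d) =
    let o , t+o≡k = ℕₚ.m≤n⇒∃[o]m+o≡n t≤k in
    mod-p^ (ℤᵈ.∣-trans (ℤᵈ.divides (+p^ o) (trans (cong +p^_ (sym t+o≡k)) (trans (+p^-+ t o) (ℤₚ.*-comm (+p^ t) (+p^ o))))) d)

  +p^≡0 : ∀ {t k} → t ℕ.≤ k → +p^ k ≡[mod-p^ t ] + 0
  +p^≡0 {t} {k} t≤k = ≡ᵐ-weaken t≤k (mod-p^ (subst (+p^ k ℤᵈ.∣_) (sym (ℤₚ.+-identityʳ (+p^ k))) ℤᵈ.∣-refl))

  +p^≡ᵐ0 : ∀ k → +p^ k ≡[mod-p^ k ] + 0
  +p^≡ᵐ0 k = +p^≡0 ℕₚ.≤-refl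

  %p^-≡ᵐ : ∀ k n → + (n %p^ k) ≡[mod-p^ k ] + n
  %p^-≡ᵐ k n = ≡ᵐ-sym (mod-p^ (ℤᵈ.divides (+ (n / M)) (begin
      + n ℤ.- + (n % M)                ≡⟨ +∸≡- (m%n≤m n M) ⟨
      + (n ∸ n % M)                    ≡⟨ cong (λ t → + (t ∸ n % M)) (m≡m%n+[m/n]*n n M) ⟩
      + (n % M ℕ.+ n / M ℕ.* M ∸ n % M) ≡⟨ cong +_ (ℕₚ.m+n∸m≡n (n % M) (n / M ℕ.* M)) ⟩
      + (n / M ℕ.* M)                  ≡⟨ ℤₚ.pos-* (n / M) M ⟩
      + (n / M) ℤ.* +p^ k              ∎)))
    where
    open ≡-Reasoning
    M = p ℕ.^ k
    instance
      p^k≢0 : NonZero M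
      p^k≢0 = m^n≢0 p k

  ≤∧≡ᵐ⇒%p^-≡ : ∀ {a b} k → a ℕ.≤ b → + b ≡[mod-p^ k ] + a → a %p^ k ≡ b %p^ k
  ≤∧≡ᵐ⇒%p^-≡ {a} {b} k a≤b (mod-p^ d) =
    trans (sym (%-remove-+ʳ a {{m^n≢0 p k}} p^k∣b∸a)) (cong (_%p^ k) (ℕₚ.m+[n∸m]≡n a≤b))
    where
    p^k∣b∸a : p ℕ.^ k ℕᵈ.∣ b ∸ a
    p^k∣b∸a = ℤᵈ.∣⇒∣ᵤ (subst (+p^ k ℤᵈ.∣_) (sym (+∸≡- a≤b)) d)

  ≡ᵐ⇒%p^-≡ : ∀ k a b → + a ≡[mod-p^ k ] + b → a %p^ k ≡ b %p^ k
  ≡ᵐ⇒%p^-≡ k a b a≡b with ℕₚ.≤-total a b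
  ... | inj₁ a≤b = ≤∧≡ᵐ⇒%p^-≡ k a≤b (≡ᵐ-sym a≡b)
  ... | inj₂ b≤a = sym (≤∧≡ᵐ⇒%p^-≡ k b≤a a≡b)

  <p^∧≡ᵐ⇒≡ : ∀ k {a b} → a ℕ.< p ℕ.^ k → b ℕ.< p ℕ.^ k → + a ≡[mod-p^ k ] + b → a ≡ b
  <p^∧≡ᵐ⇒≡ k {a} {b} a<p^k b<p^k a≡b =
    trans (sym (m<n⇒m%n≡m {{m^n≢0 p k}} a<p^k)) (trans (≡ᵐ⇒%p^-≡ k a b a≡b) (m<n⇒m%n≡m {{m^n≢0 p k}} b<p^k))

  val-≡ᵐ : ∀ x {t k} → t ℕ.≤ k → +val k x ≡[mod-p^ t ] +val t x
  val-≡ᵐ x {t} {k} t≤k = ≡ᵐ-sym (subst (λ v → + v ≡[mod-p^ t ] +val k x) (val-%p^ x t≤k) (%p^-≡ᵐ t (val k x)))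

  val≡%p^⇒≡ᵐ : ∀ {k z n} → val k z ≡ n %p^ k → +val k z ≡[mod-p^ k ] + n
  val≡%p^⇒≡ᵐ {k} {n = n} e = subst (λ v → + v ≡[mod-p^ k ] + n) (sym e) (%p^-≡ᵐ k n)

  val-addℤp : ∀ k x y → val k (addℤp x y) ≡ (val k x ℕ.+ val k y) %p^ k
  val-addℤp k x y = val≡%p^ k (addℤp x y) _ digits
    where
    digits : ∀ i → i ℕ.< k → dig (addℤp x y) i ≡ digitOf (val k x ℕ.+ val k y) i
    digits i i<k = trans (m%n%n≡m%n _ p) (digitOf-cong _ _ i (sym (trans
      (%-distribˡ-+ (val k x) (val k y) (p ℕ.^ suc i) {{m^n≢0 p (suc i)}})
      (cong₂ (λ a b → (a ℕ.+ b) %p^ suc i) (val-%p^ x i<k) (val-%p^ y i<k)))))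

  val-mulℤp : ∀ k x y → val k (mulℤp x y) ≡ (val k x ℕ.* val k y) %p^ k
  val-mulℤp k x y = val≡%p^ k (mulℤp x y) _ digits
    where
    digits : ∀ i → i ℕ.< k → dig (mulℤp x y) i ≡ digitOf (val k x ℕ.* val k y) i
    digits i i<k = trans (m%n%n≡m%n _ p) (digitOf-cong _ _ i (sym (trans
      (%-distribˡ-* (val k x) (val k y) (p ℕ.^ suc i) {{m^n≢0 p (suc i)}})
      (cong₂ (λ a b → (a ℕ.* b) %p^ suc i) (val-%p^ x i<k) (val-%p^ y i<k)))))

  p^∸val≡ᵐ : ∀ x {t k} → t ℕ.≤ k → + (p ℕ.^ t ∸ val t x) ≡[mod-p^ t ] + (p ℕ.^ k ∸ val k x)
  p^∸val≡ᵐ x {t} {k} t≤k = begin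
      + (p ℕ.^ t ∸ val t x) ≡⟨ +∸≡- (ℕₚ.<⇒≤ (val<p^ t x)) ⟩
      +p^ t ℤ.- +val t x    ≈⟨ ≡ᵐ---cong (≡ᵐ-trans (+p^≡ᵐ0 t) (≡ᵐ-sym (+p^≡0 t≤k))) (≡ᵐ-sym (val-≡ᵐ x t≤k)) ⟩
      +p^ k ℤ.- +val k x    ≡⟨ +∸≡- (ℕₚ.<⇒≤ (val<p^ k x)) ⟨
      + (p ℕ.^ k ∸ val k x) ∎
    where open ≈-Reasoning (≡ᵐ-setoid t)

  val-negℤp : ∀ k x → val k (negℤp x) ≡ (p ℕ.^ k ∸ val k x) %p^ k
  val-negℤp k x = val≡%p^ k (negℤp x) _ (λ i i<k →
    trans (m%n%n≡m%n _ p) (digitOf-cong _ _ i (≡ᵐ⇒%p^-≡ (suc i) _ _ (p^∸val≡ᵐ x i<k))))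

  val-ofℕℤp : ∀ k n → val k (ofℕℤp n) ≡ n %p^ k
  val-ofℕℤp k n = val≡%p^ k (ofℕℤp n) n (λ i _ → m%n%n≡m%n _ p)

  val-cong : ∀ {x y} → x ≈ℤp y → ∀ k → val k x ≡ val k y
  val-cong e zero    = refl
  val-cong e (suc k) = cong₂ (λ a b → a ℕ.+ b ℕ.* p ℕ.^ k) (val-cong e k) (e k)

  vals⇒≈ℤp : ∀ {x y} → (∀ k → val k x ≡ val k y) → x ≈ℤp y
  vals⇒≈ℤp {x} {y} e i = ℕₚ.*-cancelʳ-≡ (dig x i) (dig y i) (p ℕ.^ i) {{m^n≢0 p i}}
    (ℕₚ.+-cancelˡ-≡ (val i x) _ _ (trans (e (suc i)) (cong (λ v → v ℕ.+ dig y i ℕ.* p ℕ.^ i) (sym (e i)))))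

  record Approx (x : ℤp) (f : ℕ → ℤ) : Set where
    constructor approx
    field approx-at : ∀ k → +val k x ≡[mod-p^ k ] f k
  open Approx public

  approx-val : ∀ x → Approx x (λ k → +val k x)
  approx-val x = approx (λ k → ≡ᵐ-refl)

  approx-addℤp : ∀ {x y f g} → Approx x f → Approx y g → Approx (addℤp x y) (λ k → f k ℤ.+ g k)
  approx-addℤp {x} {y} {f} {g} (approx ax) (approx ay) = approx λ k →
    let open ≈-Reasoning (≡ᵐ-setoid k) in begin
      +val k (addℤp x y)              ≡⟨ cong +_ (val-addℤp k x y) ⟩
      + ((val k x ℕ.+ val k y) %p^ k) ≈⟨ %p^-≡ᵐ k _ ⟩
      + (val k x ℕ.+ val k y)         ≡⟨ ℤₚ.pos-+ (val k x) (val k y) ⟩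
      +val k x ℤ.+ +val k y           ≈⟨ ≡ᵐ-+-cong (ax k) (ay k) ⟩
      f k ℤ.+ g k                     ∎

  approx-mulℤp : ∀ {x y f g} → Approx x f → Approx y g → Approx (mulℤp x y) (λ k → f k ℤ.* g k)
  approx-mulℤp {x} {y} {f} {g} (approx ax) (approx ay) = approx λ k →
    let open ≈-Reasoning (≡ᵐ-setoid k) in begin
      +val k (mulℤp x y)              ≡⟨ cong +_ (val-mulℤp k x y) ⟩
      + ((val k x ℕ.* val k y) %p^ k) ≈⟨ %p^-≡ᵐ k _ ⟩
      + (val k x ℕ.* val k y)         ≡⟨ ℤₚ.pos-* (val k x) (val k y) ⟩
      +val k x ℤ.* +val k y           ≈⟨ ≡ᵐ-*-cong (ax k) (ay k) ⟩
      f k ℤ.* g k                     ∎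

  approx-negℤp : ∀ {x f} → Approx x f → Approx (negℤp x) (λ k → ℤ.- f k)
  approx-negℤp {x} {f} (approx ax) = approx λ k →
    let open ≈-Reasoning (≡ᵐ-setoid k) in begin
      +val k (negℤp x)                ≡⟨ cong +_ (val-negℤp k x) ⟩
      + ((p ℕ.^ k ∸ val k x) %p^ k)   ≈⟨ %p^-≡ᵐ k _ ⟩
      + (p ℕ.^ k ∸ val k x)           ≡⟨ +∸≡- (ℕₚ.<⇒≤ (val<p^ k x)) ⟩
      +p^ k ℤ.- +val k x              ≈⟨ ≡ᵐ---cong (+p^≡ᵐ0 k) (ax k) ⟩
      + 0 ℤ.- f k                     ≡⟨ ℤₚ.+-identityˡ (ℤ.- f k) ⟩
      ℤ.- f k                         ∎

  approx-ofℕℤp : ∀ n → Approx (ofℕℤp n) (λ _ → + n)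
  approx-ofℕℤp n = approx (λ k → val≡%p^⇒≡ᵐ (val-ofℕℤp k n))

  approx-ofℤℤp : ∀ n → Approx (ofℤℤp n) (λ _ → n)
  approx-ofℤℤp (+ n)    = approx-ofℕℤp n
  approx-ofℤℤp -[1+ n ] = approx-negℤp (approx-ofℕℤp (suc n))

  approx⇒≈ℤp : ∀ {x y f g} → Approx x f → Approx y g → (∀ k → f k ≡[mod-p^ k ] g k) → x ≈ℤp y
  approx⇒≈ℤp {x} {y} (approx ax) (approx ay) f≡g = vals⇒≈ℤp λ k →
    <p^∧≡ᵐ⇒≡ k (val<p^ k x) (val<p^ k y) (≡ᵐ-trans (ax k) (≡ᵐ-trans (f≡g k) (≡ᵐ-sym (ay k))))

module Arithmetic (p : ℕ) {{_ : NonZero p}} where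
  open Padic p public
  open Truncation p public

  denom : Qp → ℤ
  denom z = +p^ expo z

  num : Qp → ℕ → ℤ
  num z k = +val k (unit z)

  denom-+ : ∀ x y → denom (x + y) ≡ denom x ℤ.* denom y
  denom-+ x y = +p^-+ (expo x) (expo y)

  denom-* : ∀ x y → denom (x * y) ≡ denom x ℤ.* denom y
  denom-* x y = +p^-+ (expo x) (expo y)

  record NumApprox (z : Qp) (f : ℕ → ℤ) : Set where
    constructor numApprox
    field approxNum : Approx (unit z) f
  open NumApprox public

  numApprox-num : ∀ z → NumApprox z (num z)
  numApprox-num z = numApprox (approx-val (unit z))

  numApprox-+ : ∀ {x y f g dx dy} → NumApprox x f → NumApprox y g → denom x ≡ dx → denom y ≡ dy →
                NumApprox (x + y) (λ k → dy ℤ.* f k ℤ.+ dx ℤ.* g k)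
  numApprox-+ (numApprox ax) (numApprox ay) refl refl =
    numApprox (approx-addℤp (approx-mulℤp (approx-ofℕℤp _) ax) (approx-mulℤp (approx-ofℕℤp _) ay))

  numApprox-* : ∀ {x y f g} → NumApprox x f → NumApprox y g → NumApprox (x * y) (λ k → f k ℤ.* g k)
  numApprox-* (numApprox ax) (numApprox ay) = numApprox (approx-mulℤp ax ay)

  numApprox-neg : ∀ {x f} → NumApprox x f → NumApprox (- x) (λ k → ℤ.- f k)
  numApprox-neg (numApprox ax) = numApprox (approx-negℤp ax)

  numApprox-ofℤ : ∀ n → NumApprox (ofℤ n) (λ _ → n)
  numApprox-ofℤ n = numApprox (approx-ofℤℤp n)

  ≈-intro : ∀ {x y f g} → NumApprox x f → NumApprox y g →
            (∀ k → denom y ℤ.* f k ≡[mod-p^ k ] denom x ℤ.* g k) → x ≈ y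
  ≈-intro (numApprox ax) (numApprox ay) =
    approx⇒≈ℤp (approx-mulℤp (approx-ofℕℤp _) ax) (approx-mulℤp (approx-ofℕℤp _) ay)

  ≈-intro-exact : ∀ {x y f g dx dy} → NumApprox x f → NumApprox y g → denom x ≡ dx → denom y ≡ dy →
                  (∀ k → dy ℤ.* f k ≡ dx ℤ.* g k) → x ≈ y
  ≈-intro-exact ax ay refl refl eq = ≈-intro ax ay (λ k → ≡⇒≡ᵐ (eq k))

  ≈-elim : ∀ {x y f g} → x ≈ y → NumApprox x f → NumApprox y g →
           ∀ k → denom y ℤ.* f k ≡[mod-p^ k ] denom x ℤ.* g k
  ≈-elim {x} {y} x≈y (numApprox ax) (numApprox ay) k = begin
      denom y ℤ.* _  ≈⟨ ≡ᵐ-sym (approx-at (approx-mulℤp (approx-ofℕℤp _) ax) k) ⟩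
      +val k (mulℤp (ofℕℤp (p ℕ.^ expo y)) (unit x)) ≡⟨ cong +_ (val-cong x≈y k) ⟩
      +val k (mulℤp (ofℕℤp (p ℕ.^ expo x)) (unit y)) ≈⟨ approx-at (approx-mulℤp (approx-ofℕℤp _) ay) k ⟩
      denom x ℤ.* _  ∎
    where open ≈-Reasoning (≡ᵐ-setoid k)

  ≈-elim-num : ∀ x y → x ≈ y → ∀ k → denom y ℤ.* num x k ≡[mod-p^ k ] denom x ℤ.* num y k
  ≈-elim-num x y x≈y = ≈-elim x≈y (numApprox-num x) (numApprox-num y)

  *-cancelˡ-+p^ : ∀ j k {a b} → +p^ j ℤ.* a ≡[mod-p^ j ℕ.+ k ] +p^ j ℤ.* b → a ≡[mod-p^ k ] b
  *-cancelˡ-+p^ j k {a} {b} (mod-p^ d) = mod-p^ (ℤᵈ.*-cancelˡ-∣ (+p^ j) {{m^n≢0 p j}}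
    (subst₂ ℤᵈ._∣_ (+p^-+ j k) (factor (+p^ j) a b) d))
    where
    factor : ∀ c a b → c ℤ.* a ℤ.- c ℤ.* b ≡ c ℤ.* (a ℤ.- b)
    factor = ℤ-Solver.solve-∀

  cross-num : Qp → Qp → ℕ → ℤ
  cross-num x y k = denom y ℤ.* num x k ℤ.+ denom x ℤ.* num y k

  numApprox-+-num : ∀ x y → NumApprox (x + y) (cross-num x y)
  numApprox-+-num x y = numApprox-+ (numApprox-num x) (numApprox-num y) refl refl

  numApprox-*-num : ∀ x y → NumApprox (x * y) (λ k → num x k ℤ.* num y k)
  numApprox-*-num x y = numApprox-* (numApprox-num x) (numApprox-num y)

  ≈-refl : ∀ {x} → x ≈ x
  ≈-refl {x} = ≈-intro-exact (numApprox-num x) (numApprox-num x) refl refl (λ k → refl)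

  ≈-sym : ∀ {x y} → x ≈ y → y ≈ x
  ≈-sym {x} {y} x≈y = ≈-intro (numApprox-num y) (numApprox-num x) (λ k → ≡ᵐ-sym (≈-elim-num x y x≈y k))

  ≈-intro-shifted : ∀ {x y} j →
    (∀ k → denom y ℤ.* num x (j ℕ.+ k) ≡[mod-p^ k ] denom x ℤ.* num y (j ℕ.+ k)) → x ≈ y
  ≈-intro-shifted {x} {y} j h = ≈-intro (numApprox-num x) (numApprox-num y) λ k →
    let k≤j+k = ℕₚ.m≤n+m k j
        open ≈-Reasoning (≡ᵐ-setoid k)
    in begin
      denom y ℤ.* num x k         ≈⟨ ≡ᵐ-*ˡ (denom y) (≡ᵐ-sym (val-≡ᵐ (unit x) k≤j+k)) ⟩
      denom y ℤ.* num x (j ℕ.+ k) ≈⟨ h k ⟩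
      denom x ℤ.* num y (j ℕ.+ k) ≈⟨ ≡ᵐ-*ˡ (denom x) (val-≡ᵐ (unit y) k≤j+k) ⟩
      denom x ℤ.* num y k         ∎

  ≈-trans : ∀ {x y z} → x ≈ y → y ≈ z → x ≈ z
  ≈-trans {x} {y} {z} x≈y y≈z = ≈-intro-shifted {x} {z} (expo y) (λ k → *-cancelˡ-+p^ (expo y) k (scaled (expo y ℕ.+ k)))
    where
    swap : ∀ a b c → a ℤ.* (b ℤ.* c) ≡ b ℤ.* (a ℤ.* c)
    swap = ℤ-Solver.solve-∀
    scaled : ∀ K → denom y ℤ.* (denom z ℤ.* num x K) ≡[mod-p^ K ] denom y ℤ.* (denom x ℤ.* num z K)
    scaled K = begin
      denom y ℤ.* (denom z ℤ.* num x K) ≡⟨ swap (denom y) (denom z) (num x K) ⟩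
      denom z ℤ.* (denom y ℤ.* num x K) ≈⟨ ≡ᵐ-*ˡ (denom z) (≈-elim-num x y x≈y K) ⟩
      denom z ℤ.* (denom x ℤ.* num y K) ≡⟨ swap (denom z) (denom x) (num y K) ⟩
      denom x ℤ.* (denom z ℤ.* num y K) ≈⟨ ≡ᵐ-*ˡ (denom x) (≈-elim-num y z y≈z K) ⟩
      denom x ℤ.* (denom y ℤ.* num z K) ≡⟨ swap (denom x) (denom y) (num z K) ⟩
      denom y ℤ.* (denom x ℤ.* num z K) ∎
      where open ≈-Reasoning (≡ᵐ-setoid K)

  +-cong : ∀ {x x' y y'} → x ≈ x' → y ≈ y' → x + y ≈ x' + y'
  +-cong {x} {x'} {y} {y'} x≈x' y≈y' = ≈-intro (numApprox-+-num x y) (numApprox-+-num x' y') λ k →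
    let open ≈-Reasoning (≡ᵐ-setoid k) in begin
      denom (x' + y') ℤ.* cross-num x y k
        ≡⟨ cong (ℤ._* cross-num x y k) (denom-+ x' y') ⟩
      (dx' ℤ.* dy') ℤ.* (dy ℤ.* num x k ℤ.+ dx ℤ.* num y k)
        ≡⟨ spread dx dy dx' dy' (num x k) (num y k) ⟩
      (dy ℤ.* dy') ℤ.* (dx' ℤ.* num x k) ℤ.+ (dx ℤ.* dx') ℤ.* (dy' ℤ.* num y k)
        ≈⟨ ≡ᵐ-+-cong (≡ᵐ-*ˡ (dy ℤ.* dy') (≈-elim-num x x' x≈x' k)) (≡ᵐ-*ˡ (dx ℤ.* dx') (≈-elim-num y y' y≈y' k)) ⟩
      (dy ℤ.* dy') ℤ.* (dx ℤ.* num x' k) ℤ.+ (dx ℤ.* dx') ℤ.* (dy ℤ.* num y' k)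
        ≡⟨ gather dx dy dx' dy' (num x' k) (num y' k) ⟩
      (dx ℤ.* dy) ℤ.* (dy' ℤ.* num x' k ℤ.+ dx' ℤ.* num y' k)
        ≡⟨ cong (ℤ._* cross-num x' y' k) (denom-+ x y) ⟨
      denom (x + y) ℤ.* cross-num x' y' k ∎
    where
    dx = denom x
    dy = denom y
    dx' = denom x'
    dy' = denom y'
    spread : ∀ a b a' b' m n →
      (a' ℤ.* b') ℤ.* (b ℤ.* m ℤ.+ a ℤ.* n) ≡ (b ℤ.* b') ℤ.* (a' ℤ.* m) ℤ.+ (a ℤ.* a') ℤ.* (b' ℤ.* n)
    spread = ℤ-Solver.solve-∀
    gather : ∀ a b a' b' m n →
      (b ℤ.* b') ℤ.* (a ℤ.* m) ℤ.+ (a ℤ.* a') ℤ.* (b ℤ.* n) ≡ (a ℤ.* b) ℤ.* (b' ℤ.* m ℤ.+ a' ℤ.* n)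
    gather = ℤ-Solver.solve-∀

  *-cong : ∀ {x x' y y'} → x ≈ x' → y ≈ y' → x * y ≈ x' * y'
  *-cong {x} {x'} {y} {y'} x≈x' y≈y' = ≈-intro (numApprox-*-num x y) (numApprox-*-num x' y') λ k →
    let open ≈-Reasoning (≡ᵐ-setoid k) in begin
      denom (x' * y') ℤ.* (num x k ℤ.* num y k)         ≡⟨ cong (ℤ._* (num x k ℤ.* num y k)) (denom-* x' y') ⟩
      (denom x' ℤ.* denom y') ℤ.* (num x k ℤ.* num y k)  ≡⟨ interchange (denom x') (denom y') (num x k) (num y k) ⟩
      (denom x' ℤ.* num x k) ℤ.* (denom y' ℤ.* num y k)  ≈⟨ ≡ᵐ-*-cong (≈-elim-num x x' x≈x' k) (≈-elim-num y y' y≈y' k) ⟩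
      (denom x ℤ.* num x' k) ℤ.* (denom y ℤ.* num y' k)  ≡⟨ interchange (denom x) (denom y) (num x' k) (num y' k) ⟨
      (denom x ℤ.* denom y) ℤ.* (num x' k ℤ.* num y' k)  ≡⟨ cong (ℤ._* (num x' k ℤ.* num y' k)) (denom-* x y) ⟨
      denom (x * y) ℤ.* (num x' k ℤ.* num y' k)         ∎
    where
    interchange : ∀ a b c d → (a ℤ.* b) ℤ.* (c ℤ.* d) ≡ (a ℤ.* c) ℤ.* (b ℤ.* d)
    interchange = ℤ-Solver.solve-∀

  -‿cong : ∀ {x x'} → x ≈ x' → - x ≈ - x'
  -‿cong {x} {x'} x≈x' = ≈-intro (numApprox-neg (numApprox-num x)) (numApprox-neg (numApprox-num x')) λ k →
    let open ≈-Reasoning (≡ᵐ-setoid k) in begin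
      denom x' ℤ.* ℤ.- num x k    ≡⟨ ℤₚ.neg-distribʳ-* (denom x') (num x k) ⟨
      ℤ.- (denom x' ℤ.* num x k)  ≈⟨ ≡ᵐ-neg-cong (≈-elim-num x x' x≈x' k) ⟩
      ℤ.- (denom x ℤ.* num x' k)  ≡⟨ ℤₚ.neg-distribʳ-* (denom x) (num x' k) ⟩
      denom x ℤ.* ℤ.- num x' k    ∎

  denom-+-+ : ∀ x y z → denom ((x + y) + z) ≡ (denom x ℤ.* denom y) ℤ.* denom z
  denom-+-+ x y z = trans (denom-+ (x + y) z) (cong (ℤ._* denom z) (denom-+ x y))

  +-comm : ∀ x y → x + y ≈ y + x
  +-comm x y = ≈-intro-exact (numApprox-+-num x y) (numApprox-+-num y x) (denom-+ x y) (denom-+ y x)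
    (λ k → identity (denom x) (denom y) (num x k) (num y k))
    where
    identity : ∀ a b m n → (b ℤ.* a) ℤ.* (b ℤ.* m ℤ.+ a ℤ.* n) ≡ (a ℤ.* b) ℤ.* (a ℤ.* n ℤ.+ b ℤ.* m)
    identity = ℤ-Solver.solve-∀

  +-assoc : ∀ x y z → (x + y) + z ≈ x + (y + z)
  +-assoc x y z = ≈-intro-exact
    (numApprox-+ (numApprox-+-num x y) (numApprox-num z) (denom-+ x y) refl)
    (numApprox-+ (numApprox-num x) (numApprox-+-num y z) refl (denom-+ y z))
    (denom-+-+ x y z) (trans (denom-+ x (y + z)) (cong (denom x ℤ.*_) (denom-+ y z)))
    (λ k → identity (denom x) (denom y) (denom z) (num x k) (num y k) (num z k))
    where
    identity : ∀ a b c l m n →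
      (a ℤ.* (b ℤ.* c)) ℤ.* (c ℤ.* (b ℤ.* l ℤ.+ a ℤ.* m) ℤ.+ (a ℤ.* b) ℤ.* n)
      ≡ ((a ℤ.* b) ℤ.* c) ℤ.* ((b ℤ.* c) ℤ.* l ℤ.+ a ℤ.* (c ℤ.* m ℤ.+ b ℤ.* n))
    identity = ℤ-Solver.solve-∀

  +-identityˡ : ∀ x → 0ₚ + x ≈ x
  +-identityˡ x = ≈-intro-exact (numApprox-+ (numApprox-ofℤ (+ 0)) (numApprox-num x) refl refl) (numApprox-num x)
    refl refl (λ k → identity (denom x) (num x k))
    where
    identity : ∀ a m → a ℤ.* (a ℤ.* + 0 ℤ.+ + 1 ℤ.* m) ≡ a ℤ.* m
    identity = ℤ-Solver.solve-∀

  -‿inverseˡ : ∀ x → (- x) + x ≈ 0ₚ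
  -‿inverseˡ x = ≈-intro-exact (numApprox-+ (numApprox-neg (numApprox-num x)) (numApprox-num x) refl refl)
    (numApprox-ofℤ (+ 0)) (denom-+ x x) refl (λ k → identity (denom x) (num x k))
    where
    identity : ∀ a m → + 1 ℤ.* (a ℤ.* ℤ.- m ℤ.+ a ℤ.* m) ≡ (a ℤ.* a) ℤ.* + 0
    identity = ℤ-Solver.solve-∀

  *-assoc : ∀ x y z → (x * y) * z ≈ x * (y * z)
  *-assoc x y z = ≈-intro-exact
    (numApprox-* (numApprox-*-num x y) (numApprox-num z)) (numApprox-* (numApprox-num x) (numApprox-*-num y z))
    (trans (denom-* (x * y) z) (cong (ℤ._* denom z) (denom-* x y)))
    (trans (denom-* x (y * z)) (cong (denom x ℤ.*_) (denom-* y z)))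
    (λ k → identity (denom x) (denom y) (denom z) (num x k) (num y k) (num z k))
    where
    identity : ∀ a b c l m n →
      (a ℤ.* (b ℤ.* c)) ℤ.* ((l ℤ.* m) ℤ.* n) ≡ ((a ℤ.* b) ℤ.* c) ℤ.* (l ℤ.* (m ℤ.* n))
    identity = ℤ-Solver.solve-∀

  *-comm : ∀ x y → x * y ≈ y * x
  *-comm x y = ≈-intro-exact (numApprox-*-num x y) (numApprox-*-num y x) (denom-* x y) (denom-* y x)
    (λ k → identity (denom x) (denom y) (num x k) (num y k))
    where
    identity : ∀ a b m n → (b ℤ.* a) ℤ.* (m ℤ.* n) ≡ (a ℤ.* b) ℤ.* (n ℤ.* m)
    identity = ℤ-Solver.solve-∀

  *-identityˡ : ∀ x → 1ₚ * x ≈ x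
  *-identityˡ x = ≈-intro-exact (numApprox-* (numApprox-ofℤ (+ 1)) (numApprox-num x)) (numApprox-num x)
    refl refl (λ k → cong (denom x ℤ.*_) (ℤₚ.*-identityˡ (num x k)))

  *-distribʳ-+ : ∀ x y z → (y + z) * x ≈ (y * x) + (z * x)
  *-distribʳ-+ x y z = ≈-intro-exact
    (numApprox-* (numApprox-+-num y z) (numApprox-num x))
    (numApprox-+ (numApprox-*-num y x) (numApprox-*-num z x) (denom-* y x) (denom-* z x))
    (trans (denom-* (y + z) x) (cong (ℤ._* denom x) (denom-+ y z)))
    (trans (denom-+ (y * x) (z * x)) (cong₂ ℤ._*_ (denom-* y x) (denom-* z x)))
    (λ k → identity (denom x) (denom y) (denom z) (num x k) (num y k) (num z k))
    where
    identity : ∀ a b c l m n →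
      ((b ℤ.* a) ℤ.* (c ℤ.* a)) ℤ.* ((c ℤ.* m ℤ.+ b ℤ.* n) ℤ.* l)
      ≡ ((b ℤ.* c) ℤ.* a) ℤ.* ((c ℤ.* a) ℤ.* (m ℤ.* l) ℤ.+ (b ℤ.* a) ℤ.* (n ℤ.* l))
    identity = ℤ-Solver.solve-∀

  ofℤ-+ : ∀ a b → ofℤ (a ℤ.+ b) ≈ ofℤ a + ofℤ b
  ofℤ-+ a b = ≈-intro-exact (numApprox-ofℤ (a ℤ.+ b)) (numApprox-+ (numApprox-ofℤ a) (numApprox-ofℤ b) refl refl)
    refl refl (λ k → identity a b)
    where
    identity : ∀ a b → + 1 ℤ.* (a ℤ.+ b) ≡ + 1 ℤ.* (+ 1 ℤ.* a ℤ.+ + 1 ℤ.* b)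
    identity = ℤ-Solver.solve-∀

  ofℤ-* : ∀ a b → ofℤ (a ℤ.* b) ≈ ofℤ a * ofℤ b
  ofℤ-* a b = ≈-intro-exact (numApprox-ofℤ (a ℤ.* b)) (numApprox-* (numApprox-ofℤ a) (numApprox-ofℤ b))
    refl refl (λ k → refl)

  ofℤ-neg : ∀ a → ofℤ (ℤ.- a) ≈ - ofℤ a
  ofℤ-neg a = ≈-intro-exact (numApprox-ofℤ (ℤ.- a)) (numApprox-neg (numApprox-ofℤ a)) refl refl (λ k → refl)

  -- x ≈ y unfolds (by η) to a statement about digits from which x and y cannot be recovered.
  infix 4 _≃_
  record _≃_ (x y : Qp) : Set where
    constructor ≈⇒≃
    field ≃⇒≈ : x ≈ y
  open _≃_ public

  ≃-setoid : Setoid 0ℓ 0ℓ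
  ≃-setoid = record
    { Carrier = Qp
    ; _≈_ = _≃_
    ; isEquivalence = record
      { refl  = λ {x} → ≈⇒≃ (≈-refl {x})
      ; sym   = λ {x} {y} x≃y → ≈⇒≃ (≈-sym {x} {y} (≃⇒≈ x≃y))
      ; trans = λ {x} {y} {z} x≃y y≃z → ≈⇒≃ (≈-trans {x} {y} {z} (≃⇒≈ x≃y) (≃⇒≈ y≃z))
      }
    }
  open Setoid ≃-setoid public using () renaming (refl to ≃-refl; sym to ≃-sym; trans to ≃-trans)

  +-≃-cong : ∀ {x x' y y'} → x ≃ x' → y ≃ y' → x + y ≃ x' + y'
  +-≃-cong {x} {x'} {y} {y'} (≈⇒≃ e) (≈⇒≃ f) = ≈⇒≃ (+-cong {x} {x'} {y} {y'} e f)

  *-≃-cong : ∀ {x x' y y'} → x ≃ x' → y ≃ y' → x * y ≃ x' * y'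
  *-≃-cong {x} {x'} {y} {y'} (≈⇒≃ e) (≈⇒≃ f) = ≈⇒≃ (*-cong {x} {x'} {y} {y'} e f)

  -‿≃-cong : ∀ {x x'} → x ≃ x' → - x ≃ - x'
  -‿≃-cong {x} {x'} (≈⇒≃ e) = ≈⇒≃ (-‿cong {x} {x'} e)

  -- Equational reasoning in Qp is done with opaque copies of the operations: through η for Qp the
  -- originals unfold into digit sequences that mention each argument twice, so the type checker's
  -- comparison of even moderately deep terms built from them blows up exponentially.
  infixl 6 _⊕_ _⊖_
  infixl 7 _⊗_
  infix  8 ⊖_
  opaque
    _⊕_ : Qp → Qp → Qp
    _⊕_ = _+_

    _⊗_ : Qp → Qp → Qp
    _⊗_ = _*_

    ⊖_ : Qp → Qp
    ⊖_ = -_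

  _⊖_ : Qp → Qp → Qp
  x ⊖ y = x ⊕ ⊖ y

  open Algebra.Consequences.Setoid ≃-setoid using (comm∧idˡ⇒id; comm∧invˡ⇒inv; comm∧distrʳ⇒distr)

  opaque
    unfolding _⊕_ _⊗_ ⊖_

    ⊕≡+ : ∀ x y → x ⊕ y ≡ x + y
    ⊕≡+ x y = refl

    ⊗≡* : ∀ x y → x ⊗ y ≡ x * y
    ⊗≡* x y = refl

    ⊖≡- : ∀ x → ⊖ x ≡ - x
    ⊖≡- x = refl

    ofℤ-+-homo : ∀ a b → ofℤ (a ℤ.+ b) ≃ ofℤ a ⊕ ofℤ b
    ofℤ-+-homo a b = ≈⇒≃ (ofℤ-+ a b)

    ofℤ-*-homo : ∀ a b → ofℤ (a ℤ.* b) ≃ ofℤ a ⊗ ofℤ b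
    ofℤ-*-homo a b = ≈⇒≃ (ofℤ-* a b)

    ofℤ-neg-homo : ∀ a → ofℤ (ℤ.- a) ≃ ⊖ ofℤ a
    ofℤ-neg-homo a = ≈⇒≃ (ofℤ-neg a)

    Qp-isCommutativeRing : IsCommutativeRing _≃_ _⊕_ _⊗_ ⊖_ 0ₚ 1ₚ
    Qp-isCommutativeRing = record
      { isRing = record
        { +-isAbelianGroup = record
          { isGroup = record
            { isMonoid = record
              { isSemigroup = record
                { isMagma = record { isEquivalence = Setoid.isEquivalence ≃-setoid ; ∙-cong = +-≃-cong }
                ; assoc = λ x y z → ≈⇒≃ (+-assoc x y z) }
              ; identity = comm∧idˡ⇒id +-comm' (λ x → ≈⇒≃ (+-identityˡ x)) }
            ; inverse = comm∧invˡ⇒inv +-comm' (λ x → ≈⇒≃ (-‿inverseˡ x))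
            ; ⁻¹-cong = -‿≃-cong }
          ; comm = +-comm' }
        ; *-cong = *-≃-cong
        ; *-assoc = λ x y z → ≈⇒≃ (*-assoc x y z)
        ; *-identity = comm∧idˡ⇒id *-comm' (λ x → ≈⇒≃ (*-identityˡ x))
        ; distrib = comm∧distrʳ⇒distr +-≃-cong *-comm' (λ x y z → ≈⇒≃ (*-distribʳ-+ x y z)) }
      ; *-comm = *-comm' }
      where
      +-comm' : ∀ x y → x + y ≃ y + x
      +-comm' x y = ≈⇒≃ (+-comm x y)
      *-comm' : ∀ x y → x * y ≃ y * x
      *-comm' x y = ≈⇒≃ (*-comm x y)

  ⊖≡-₂ : ∀ x y → x ⊖ y ≡ x - y
  ⊖≡-₂ x y = trans (⊕≡+ x (⊖ y)) (cong (_+_ x) (⊖≡- y))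

  ⊕⊗≡+* : ∀ x y z → x ⊕ y ⊗ z ≡ x + y * z
  ⊕⊗≡+* x y z = trans (⊕≡+ x (y ⊗ z)) (cong (_+_ x) (⊗≡* y z))

  ⊕≈+ : ∀ x y → x ⊕ y ≈ x + y
  ⊕≈+ x y = subst (x ⊕ y ≈_) (⊕≡+ x y) (≈-refl {x ⊕ y})

  ⊗≃⇒*≈ : ∀ {x y z} → x ⊗ y ≃ z → x * y ≈ z
  ⊗≃⇒*≈ {x} {y} {z} (≈⇒≃ e) = subst (_≈ z) (⊗≡* x y) e

  Qp-almostCommutativeRing : ACR.AlmostCommutativeRing 0ℓ 0ℓ
  Qp-almostCommutativeRing = ACR.fromCommutativeRing (record { isCommutativeRing = Qp-isCommutativeRing })
  open ACR.AlmostCommutativeRing Qp-almostCommutativeRing public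
    using () renaming (+-cong to ⊕-cong; *-cong to ⊗-cong; -‿cong to ⊖-cong)

  ofℤ-morphism : ℤ.+-*-rawRing ACR.-Raw-AlmostCommutative⟶ Qp-almostCommutativeRing
  ofℤ-morphism = record
    { ⟦_⟧ = ofℤ ; +-homo = ofℤ-+-homo ; *-homo = ofℤ-*-homo ; -‿homo = ofℤ-neg-homo ; 0-homo = ≃-refl ; 1-homo = ≃-refl }

  ofℤ-≟ : ∀ a b → Maybe (ofℤ a ≃ ofℤ b)
  ofℤ-≟ a b with a ℤ.≟ b
  ... | yes refl = just ≃-refl
  ... | no _     = nothing

  module Qp-Solver = Algebra.Solver.Ring ℤ.+-*-rawRing Qp-almostCommutativeRing ofℤ-morphism ofℤ-≟

module PrimePowers (p : ℕ) (p-prime : Prime p) where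
  private instance
    p≢0 : NonZero p
    p≢0 = prime⇒nonZero p-prime

  p^t∣a*b∧p∤a⇒p^t∣b : ∀ {a b} t → ¬ p ℕᵈ.∣ a → p ℕ.^ t ℕᵈ.∣ a ℕ.* b → p ℕ.^ t ℕᵈ.∣ b
  p^t∣a*b∧p∤a⇒p^t∣b zero    _   _ = ℕᵈ.1∣ _
  p^t∣a*b∧p∤a⇒p^t∣b {a} {b} (suc t) p∤a p^[1+t]∣ab
    with euclidsLemma a b p-prime (ℕᵈ.∣-trans (ℕᵈ.m∣m*n (p ℕ.^ t)) p^[1+t]∣ab)
  ... | inj₁ p∣a                 = ⊥-elim (p∤a p∣a)
  ... | inj₂ (ℕᵈ.divides q refl) = subst (p ℕ.^ suc t ℕᵈ.∣_) (ℕₚ.*-comm p q) (ℕᵈ.*-monoʳ-∣ p p^t∣q)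
    where
    shuffle : a ℕ.* (q ℕ.* p) ≡ p ℕ.* (a ℕ.* q)
    shuffle = trans (sym (ℕₚ.*-assoc a q p)) (ℕₚ.*-comm (a ℕ.* q) p)
    p^t∣q : p ℕ.^ t ℕᵈ.∣ q
    p^t∣q = p^t∣a*b∧p∤a⇒p^t∣b t p∤a (ℕᵈ.*-cancelˡ-∣ p (subst (p ℕ.^ suc t ℕᵈ.∣_) shuffle p^[1+t]∣ab))

  p^[s+t]∣a*b∧p^[1+s]∤a⇒p^t∣b : ∀ {a b} s t → ¬ p ℕ.^ suc s ℕᵈ.∣ a → p ℕ.^ (s ℕ.+ t) ℕᵈ.∣ a ℕ.* b →
                                p ℕ.^ t ℕᵈ.∣ b
  p^[s+t]∣a*b∧p^[1+s]∤a⇒p^t∣b {a} zero t p∤a p^t∣ab =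
    p^t∣a*b∧p∤a⇒p^t∣b t (λ p∣a → p∤a (subst (ℕᵈ._∣ a) (sym (ℕₚ.*-identityʳ p)) p∣a)) p^t∣ab
  p^[s+t]∣a*b∧p^[1+s]∤a⇒p^t∣b {a} {b} (suc s) t p^[2+s]∤a p^[1+s+t]∣ab with p ℕᵈ.∣? a
  ... | no p∤a = p^t∣a*b∧p∤a⇒p^t∣b t p∤a (ℕᵈ.∣-trans p^t∣p^[1+s+t] p^[1+s+t]∣ab)
    where
    p^t∣p^[1+s+t] : p ℕ.^ t ℕᵈ.∣ p ℕ.^ (suc s ℕ.+ t)
    p^t∣p^[1+s+t] = subst (p ℕ.^ t ℕᵈ.∣_) (sym (ℕₚ.^-distribˡ-+-* p (suc s) t)) (ℕᵈ.n∣m*n (p ℕ.^ suc s))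
  ... | yes (ℕᵈ.divides q refl) = p^[s+t]∣a*b∧p^[1+s]∤a⇒p^t∣b s t p^[1+s]∤q
          (ℕᵈ.*-cancelˡ-∣ p (subst (p ℕ.^ suc (s ℕ.+ t) ℕᵈ.∣_) shuffle p^[1+s+t]∣ab))
    where
    p^[1+s]∤q : ¬ p ℕ.^ suc s ℕᵈ.∣ q
    p^[1+s]∤q h = p^[2+s]∤a (subst (p ℕ.^ suc (suc s) ℕᵈ.∣_) (ℕₚ.*-comm p q) (ℕᵈ.*-monoʳ-∣ p h))
    shuffle : q ℕ.* p ℕ.* b ≡ p ℕ.* (q ℕ.* b)
    shuffle = trans (cong (ℕ._* b) (ℕₚ.*-comm q p)) (ℕₚ.*-assoc p q b)

  n<p^n : ∀ n → n ℕ.< p ℕ.^ n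
  n<p^n zero    = s≤s z≤n
  n<p^n (suc n) = begin
      suc (suc n)            ≤⟨ ℕₚ.+-mono-≤ (ℕₚ.m^n>0 p n) (n<p^n n) ⟩
      p ℕ.^ n ℕ.+ p ℕ.^ n    ≡⟨ cong (p ℕ.^ n ℕ.+_) (ℕₚ.+-identityʳ (p ℕ.^ n)) ⟨
      2 ℕ.* p ℕ.^ n          ≤⟨ ℕₚ.*-monoˡ-≤ (p ℕ.^ n) (ℕ.nonTrivial⇒n>1 p {{prime⇒nonTrivial p-prime}}) ⟩
      p ℕ.* p ℕ.^ n          ∎
    where open ℕₚ.≤-Reasoning

  p^[1+n]∤n : ∀ n → n ≢ 0 → ¬ p ℕ.^ suc n ℕᵈ.∣ n
  p^[1+n]∤n n n≢0 p^[1+n]∣n = ℕₚ.<-irrefl refl (ℕₚ.<-≤-trans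
    (ℕₚ.<-trans (ℕₚ.n<1+n n) (n<p^n (suc n))) (ℕᵈ.∣⇒≤ {{ℕ.≢-nonZero n≢0}} p^[1+n]∣n))

module Valuation (p : ℕ) {{_ : NonZero p}} (p-prime : Prime p) where
  open Arithmetic p public
  open PrimePowers p p-prime

  ≡ᵐ0⇒∣∣ : ∀ {t a} → a ≡[mod-p^ t ] + 0 → p ℕ.^ t ℕᵈ.∣ ∣ a ∣
  ≡ᵐ0⇒∣∣ {t} {a} (mod-p^ d) = ℤᵈ.∣⇒∣ᵤ (subst (+p^ t ℤᵈ.∣_) (ℤₚ.+-identityʳ a) d)

  ∣∣⇒≡ᵐ0 : ∀ {t a} → p ℕ.^ t ℕᵈ.∣ ∣ a ∣ → a ≡[mod-p^ t ] + 0
  ∣∣⇒≡ᵐ0 {t} {a} d = mod-p^ (subst (+p^ t ℤᵈ.∣_) (sym (ℤₚ.+-identityʳ a)) (ℤᵈ.∣ᵤ⇒∣ d))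

  -- A nonzero integer n has p-adic valuation below 1 + ∣n∣, so multiplying by it costs at most ∣n∣ digits.
  *-cancelˡ-≡ᵐ : ∀ n k {a b} → n ≢ + 0 → n ℤ.* a ≡[mod-p^ ∣ n ∣ ℕ.+ k ] n ℤ.* b → a ≡[mod-p^ k ] b
  *-cancelˡ-≡ᵐ n k {a} {b} n≢0 (mod-p^ d) = mod-p^ (ℤᵈ.∣ᵤ⇒∣
    (p^[s+t]∣a*b∧p^[1+s]∤a⇒p^t∣b ∣ n ∣ k (p^[1+n]∤n ∣ n ∣ (n≢0 ∘ ℤₚ.∣i∣≡0⇒i≡0))
      (subst (p ℕ.^ (∣ n ∣ ℕ.+ k) ℕᵈ.∣_) (ℤₚ.abs-* n (a ℤ.- b))
        (ℤᵈ.∣⇒∣ᵤ (subst (+p^ (∣ n ∣ ℕ.+ k) ℤᵈ.∣_) (factor n a b) d)))))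
    where
    factor : ∀ n a b → n ℤ.* a ℤ.- n ℤ.* b ≡ n ℤ.* (a ℤ.- b)
    factor = ℤ-Solver.solve-∀

  *-cancelˡ-ofℤ : ∀ n x y → n ≢ + 0 → ofℤ n * x ≈ ofℤ n * y → x ≈ y
  *-cancelˡ-ofℤ n x y n≢0 nx≈ny = ≈-intro-shifted {x} {y} ∣ n ∣ λ k →
    let K = ∣ n ∣ ℕ.+ k
        open ≈-Reasoning (≡ᵐ-setoid K)
    in *-cancelˡ-≡ᵐ n k n≢0 (begin
      n ℤ.* (denom y ℤ.* num x K) ≡⟨ swap n (denom y) (num x K) ⟩
      denom y ℤ.* (n ℤ.* num x K) ≈⟨ ≈-elim nx≈ny (numApprox-* (numApprox-ofℤ n) (numApprox-num x))
                                                   (numApprox-* (numApprox-ofℤ n) (numApprox-num y)) K ⟩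
      denom x ℤ.* (n ℤ.* num y K) ≡⟨ swap (denom x) n (num y K) ⟩
      n ℤ.* (denom x ℤ.* num y K) ∎)
    where
    swap : ∀ a b c → a ℤ.* (b ℤ.* c) ≡ b ℤ.* (a ℤ.* c)
    swap = ℤ-Solver.solve-∀

  ≡ᵐ-reindex : ∀ {t t' a b} → t ≡ t' → a ≡[mod-p^ t ] b → a ≡[mod-p^ t' ] b
  ≡ᵐ-reindex refl a≡b = a≡b

  ≡ᵐ0-* : ∀ {t t' a b} → a ≡[mod-p^ t ] + 0 → b ≡[mod-p^ t' ] + 0 → a ℤ.* b ≡[mod-p^ t ℕ.+ t' ] + 0
  ≡ᵐ0-* {t} {t'} {a} {b} a≡0 b≡0 = ∣∣⇒≡ᵐ0 (subst₂ ℕᵈ._∣_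
    (sym (ℕₚ.^-distribˡ-+-* p t t')) (sym (ℤₚ.abs-* a b)) (ℕᵈ.*-pres-∣ (≡ᵐ0⇒∣∣ a≡0) (≡ᵐ0⇒∣∣ b≡0)))

  -- s ≤v z means v_p(z) ≥ s: z = p^(-expo z) · unit z with unit z ≡ 0 modulo p^(expo z + s).
  infix 4 _≤v_
  record _≤v_ (s : ℕ) (z : Qp) : Set where
    constructor mk≤v
    field ≤v-at : ∀ K → expo z ℕ.+ s ℕ.≤ K → num z K ≡[mod-p^ expo z ℕ.+ s ] + 0
  open _≤v_ public

  ≤v-intro : ∀ {s z} K → expo z ℕ.+ s ℕ.≤ K → num z K ≡[mod-p^ expo z ℕ.+ s ] + 0 → s ≤v z
  ≤v-intro {s} {z} K t≤K z≡0 = mk≤v λ K' t≤K' →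
    ≡ᵐ-trans (val-≡ᵐ (unit z) t≤K') (≡ᵐ-trans (≡ᵐ-sym (val-≡ᵐ (unit z) t≤K)) z≡0)

  val≡0⇒≤v : ∀ s z → val (expo z ℕ.+ s) (unit z) ≡ 0 → s ≤v z
  val≡0⇒≤v s z val≡0 = ≤v-intro (expo z ℕ.+ s) ℕₚ.≤-refl (≡⇒≡ᵐ (cong +_ val≡0))

  ≤v⇒val≡0 : ∀ s z → s ≤v z → val (expo z ℕ.+ s) (unit z) ≡ 0
  ≤v⇒val≡0 s z s≤v =
    <p^∧≡ᵐ⇒≡ t (val<p^ t (unit z)) (ℕₚ.m^n>0 p t) (≤v-at s≤v t ℕₚ.≤-refl)
    where t = expo z ℕ.+ s

  ≤v? : ∀ s z → Dec (s ≤v z)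
  ≤v? s z = Dec.map′ (val≡0⇒≤v s z) (≤v⇒val≡0 s z) (val (expo z ℕ.+ s) (unit z) ℕ.≟ 0)

  ≤v-resp : ∀ {s x y} → x ≃ y → s ≤v x → s ≤v y
  ≤v-resp {s} {x} {y} (≈⇒≃ x≈y) s≤vx = ≤v-intro K (ℕₚ.m≤n+m (expo y ℕ.+ s) (expo x))
    (*-cancelˡ-+p^ (expo x) (expo y ℕ.+ s) (begin
      denom x ℤ.* num y K ≈⟨ ≡ᵐ-sym (≈-elim-num x y x≈y K) ⟩
      denom y ℤ.* num x K ≈⟨ ≡ᵐ-reindex (swap-+ (expo y) (expo x) s)
                              (≡ᵐ0-* (+p^≡ᵐ0 (expo y)) (≤v-at s≤vx K (ℕₚ.+-monoʳ-≤ (expo x) (ℕₚ.m≤n+m s (expo y))))) ⟩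
      + 0                 ≡⟨ ℤₚ.*-zeroʳ (denom x) ⟨
      denom x ℤ.* + 0     ∎))
    where
    K = expo x ℕ.+ (expo y ℕ.+ s)
    swap-+ : ∀ a b c → a ℕ.+ (b ℕ.+ c) ≡ b ℕ.+ (a ℕ.+ c)
    swap-+ = ℕ-Solver.solve-∀
    open ≈-Reasoning (≡ᵐ-setoid K)

  ≤v-+ : ∀ {s x y} → s ≤v x → s ≤v y → s ≤v (x + y)
  ≤v-+ {s} {x} {y} s≤vx s≤vy = ≤v-intro K ℕₚ.≤-refl (begin
      num (x + y) K                               ≈⟨ approx-at (approxNum (numApprox-+-num x y)) K ⟩
      denom y ℤ.* num x K ℤ.+ denom x ℤ.* num y K ≈⟨ ≡ᵐ-+-cong x-part y-part ⟩
      + 0                                         ∎)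
    where
    K = (expo x ℕ.+ expo y) ℕ.+ s
    regroupˡ : ∀ a b c → b ℕ.+ (a ℕ.+ c) ≡ (a ℕ.+ b) ℕ.+ c
    regroupˡ = ℕ-Solver.solve-∀
    regroupʳ : ∀ a b c → a ℕ.+ (b ℕ.+ c) ≡ (a ℕ.+ b) ℕ.+ c
    regroupʳ = ℕ-Solver.solve-∀
    x-part : denom y ℤ.* num x K ≡[mod-p^ K ] + 0
    x-part = ≡ᵐ-reindex (regroupˡ (expo x) (expo y) s)
      (≡ᵐ0-* (+p^≡ᵐ0 (expo y)) (≤v-at s≤vx K (ℕₚ.+-monoˡ-≤ s (ℕₚ.m≤m+n (expo x) (expo y)))))
    y-part : denom x ℤ.* num y K ≡[mod-p^ K ] + 0
    y-part = ≡ᵐ-reindex (regroupʳ (expo x) (expo y) s)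
      (≡ᵐ0-* (+p^≡ᵐ0 (expo x)) (≤v-at s≤vy K (ℕₚ.+-monoˡ-≤ s (ℕₚ.m≤n+m (expo y) (expo x)))))
    open ≈-Reasoning (≡ᵐ-setoid K)

  ≤v-neg : ∀ {s x} → s ≤v x → s ≤v (- x)
  ≤v-neg {s} {x} s≤vx = ≤v-intro K ℕₚ.≤-refl
    (≡ᵐ-trans (approx-at (approxNum (numApprox-neg (numApprox-num x))) K) (≡ᵐ-neg-cong (≤v-at s≤vx K ℕₚ.≤-refl)))
    where K = expo x ℕ.+ s

  ≤v-* : ∀ {s s' x y} → s ≤v x → s' ≤v y → s ℕ.+ s' ≤v x * y
  ≤v-* {s} {s'} {x} {y} s≤vx s'≤vy = ≤v-intro K ℕₚ.≤-refl
    (≡ᵐ-trans (approx-at (approxNum (numApprox-*-num x y)) K)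
      (≡ᵐ-reindex (interchange (expo x) s (expo y) s')
        (≡ᵐ0-* (≤v-at s≤vx K (ℕₚ.+-mono-≤ (ℕₚ.m≤m+n (expo x) (expo y)) (ℕₚ.m≤m+n s s')))
               (≤v-at s'≤vy K (ℕₚ.+-mono-≤ (ℕₚ.m≤n+m (expo y) (expo x)) (ℕₚ.m≤n+m s' s))))))
    where
    K = (expo x ℕ.+ expo y) ℕ.+ (s ℕ.+ s')
    interchange : ∀ a b c d → (a ℕ.+ b) ℕ.+ (c ℕ.+ d) ≡ (a ℕ.+ c) ℕ.+ (b ℕ.+ d)
    interchange = ℕ-Solver.solve-∀

  ≤v-⊕ : ∀ {s x y} → s ≤v x → s ≤v y → s ≤v x ⊕ y
  ≤v-⊕ {s} {x} {y} s≤vx s≤vy = subst (s ≤v_) (sym (⊕≡+ x y)) (≤v-+ s≤vx s≤vy)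

  ≤v-⊖ : ∀ {s x} → s ≤v x → s ≤v ⊖ x
  ≤v-⊖ {s} {x} s≤vx = subst (s ≤v_) (sym (⊖≡- x)) (≤v-neg s≤vx)

  ≤v-⊗ : ∀ {s s' x y} → s ≤v x → s' ≤v y → s ℕ.+ s' ≤v x ⊗ y
  ≤v-⊗ {s} {s'} {x} {y} s≤vx s'≤vy = subst (s ℕ.+ s' ≤v_) (sym (⊗≡* x y)) (≤v-* s≤vx s'≤vy)

  ≤v-weaken : ∀ {s z} → suc s ≤v z → s ≤v z
  ≤v-weaken {s} {z} 1+s≤vz =
    ≤v-intro (expo z ℕ.+ suc s) e+s≤e+1+s (≡ᵐ-weaken e+s≤e+1+s (≤v-at 1+s≤vz _ ℕₚ.≤-refl))
    where
    e+s≤e+1+s : expo z ℕ.+ s ℕ.≤ expo z ℕ.+ suc s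
    e+s≤e+1+s = ℕₚ.+-monoʳ-≤ (expo z) (ℕₚ.n≤1+n s)

  0≤v1ₚ : 0 ≤v 1ₚ
  0≤v1ₚ = val≡0⇒≤v 0 1ₚ refl

  1≰v1ₚ : ¬ 1 ≤v 1ₚ
  1≰v1ₚ 1≤v1 = ℕₚ.1+n≢0 (begin
      1          ≡⟨ m<n⇒m%n≡m {{m^n≢0 p 1}} 1<p^1 ⟨
      1 %p^ 1    ≡⟨ val-ofℕℤp 1 1 ⟨
      val 1 (unit 1ₚ) ≡⟨ ≤v⇒val≡0 1 1ₚ 1≤v1 ⟩
      0          ∎)
    where
    open ≡-Reasoning
    1<p^1 : 1 ℕ.< p ℕ.^ 1
    1<p^1 = subst (1 ℕ.<_) (sym (ℕₚ.*-identityʳ p)) (ℕ.nonTrivial⇒n>1 p {{prime⇒nonTrivial p-prime}})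

  InZp⇒0≤v : ∀ z → InZp z → 0 ≤v z
  InZp⇒0≤v z inZ = val≡0⇒≤v 0 z (subst (λ t → val t (unit z) ≡ 0) (sym (ℕₚ.+-identityʳ (expo z))) inZ)

  0≤v⇒InZp : ∀ z → 0 ≤v z → InZp z
  0≤v⇒InZp z 0≤vz = subst (λ t → val t (unit z) ≡ 0) (ℕₚ.+-identityʳ (expo z)) (≤v⇒val≡0 0 z 0≤vz)

  InpZp⇒1≤v : ∀ z → InpZp z → 1 ≤v z
  InpZp⇒1≤v z inpZ = val≡0⇒≤v 1 z (subst (λ t → val t (unit z) ≡ 0) (ℕₚ.+-comm 1 (expo z)) inpZ)

  1≤v⇒InpZp : ∀ z → 1 ≤v z → InpZp z
  1≤v⇒InpZp z 1≤vz = subst (λ t → val t (unit z) ≡ 0) (ℕₚ.+-comm (expo z) 1) (≤v⇒val≡0 1 z 1≤vz)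

  -- v(x) ≤ 0 and v(y) < 0 give v(xy) < 0: Euclid's lemma, the place where p must be prime.
  1≰v∧0≰v⇒0≰v-⊗ : ∀ {x y} → ¬ 1 ≤v x → ¬ 0 ≤v y → ¬ 0 ≤v x ⊗ y
  1≰v∧0≰v⇒0≰v-⊗ {x} {y} 1≰vx 0≰vy 0≤vx⊗y = 0≰vy (≤v-intro K ey+0≤K (∣∣⇒≡ᵐ0
    (p^[s+t]∣a*b∧p^[1+s]∤a⇒p^t∣b ex (ey ℕ.+ 0) p^[1+ex]∤x p^[ex+ey]∣xy)))
    where
    ex = expo x
    ey = expo y
    K = (ex ℕ.+ ey) ℕ.+ 1
    0≤vxy : 0 ≤v x * y
    0≤vxy = subst (0 ≤v_) (⊗≡* x y) 0≤vx⊗y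
    ex+ey+0≤K : (ex ℕ.+ ey) ℕ.+ 0 ℕ.≤ K
    ex+ey+0≤K = ℕₚ.+-monoʳ-≤ (ex ℕ.+ ey) z≤n
    ey+0≤K : ey ℕ.+ 0 ℕ.≤ K
    ey+0≤K = ℕₚ.≤-trans (ℕₚ.+-monoˡ-≤ 0 (ℕₚ.m≤n+m ey ex)) ex+ey+0≤K
    p^[1+ex]∤x : ¬ p ℕ.^ suc ex ℕᵈ.∣ ∣ num x K ∣
    p^[1+ex]∤x d = 1≰vx (≤v-intro K (ℕₚ.+-monoˡ-≤ 1 (ℕₚ.m≤m+n ex ey)) (≡ᵐ-reindex (ℕₚ.+-comm 1 ex) (∣∣⇒≡ᵐ0 d)))
    p^[ex+ey]∣xy : p ℕ.^ (ex ℕ.+ (ey ℕ.+ 0)) ℕᵈ.∣ ∣ num x K ∣ ℕ.* ∣ num y K ∣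
    p^[ex+ey]∣xy = subst₂ ℕᵈ._∣_ (cong (p ℕ.^_) (ℕₚ.+-assoc ex ey 0)) (ℤₚ.abs-* (num x K) (num y K))
      (≡ᵐ0⇒∣∣ (≡ᵐ-trans (≡ᵐ-sym (≡ᵐ-weaken ex+ey+0≤K (approx-at (approxNum (numApprox-*-num x y)) K)))
                        (≤v-at 0≤vxy K ex+ey+0≤K)))

module Rationals (p : ℕ) {{_ : NonZero p}} (p-prime : Prime p) where
  open Valuation p p-prime public
  open Qp-Solver using (solve; _:=_; _:+_; _:*_; :-_; _:-_; con)
  open ≈-Reasoning ≃-setoid

  *-cancelˡ-ofℤ≃ : ∀ n {x y} → n ≢ + 0 → ofℤ n ⊗ x ≃ ofℤ n ⊗ y → x ≃ y
  *-cancelˡ-ofℤ≃ n {x} {y} n≢0 (≈⇒≃ e) =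
    ≈⇒≃ (*-cancelˡ-ofℤ n x y n≢0 (subst₂ _≈_ (⊗≡* (ofℤ n) x) (⊗≡* (ofℤ n) y) e))

  IsRational : Qp → Set
  IsRational z = Σ ℤ λ a → Σ ℤ λ d → d ≢ + 0 × ofℤ a ≃ ofℤ d ⊗ z

  *-≢0 : ∀ {a b} → a ≢ + 0 → b ≢ + 0 → a ℤ.* b ≢ + 0
  *-≢0 {a} a≢0 b≢0 ab≡0 with ℤₚ.i*j≡0⇒i≡0∨j≡0 a ab≡0
  ... | inj₁ a≡0 = a≢0 a≡0
  ... | inj₂ b≡0 = b≢0 b≡0

  isRational-⊕ : ∀ {x y} → IsRational x → IsRational y → IsRational (x ⊕ y)
  isRational-⊕ {x} {y} (a , d , d≢0 , a≃dx) (b , e , e≢0 , b≃ey) =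
    a ℤ.* e ℤ.+ b ℤ.* d , d ℤ.* e , *-≢0 d≢0 e≢0 , (begin
    ofℤ (a ℤ.* e ℤ.+ b ℤ.* d)                 ≈⟨ ≃-trans (ofℤ-+-homo _ _) (⊕-cong (ofℤ-*-homo a e) (ofℤ-*-homo b d)) ⟩
    ofℤ a ⊗ ofℤ e ⊕ ofℤ b ⊗ ofℤ d             ≈⟨ ⊕-cong (⊗-cong a≃dx ≃-refl) (⊗-cong b≃ey ≃-refl) ⟩
    (ofℤ d ⊗ x) ⊗ ofℤ e ⊕ (ofℤ e ⊗ y) ⊗ ofℤ d ≈⟨ solve 4 (λ d e x y → (d :* x) :* e :+ (e :* y) :* d := (d :* e) :* (x :+ y))
                                                   ≃-refl (ofℤ d) (ofℤ e) x y ⟩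
    (ofℤ d ⊗ ofℤ e) ⊗ (x ⊕ y)                 ≈⟨ ⊗-cong (≃-sym (ofℤ-*-homo d e)) ≃-refl ⟩
    ofℤ (d ℤ.* e) ⊗ (x ⊕ y)                   ∎)

  isRational-⊗ : ∀ {x y} → IsRational x → IsRational y → IsRational (x ⊗ y)
  isRational-⊗ {x} {y} (a , d , d≢0 , a≃dx) (b , e , e≢0 , b≃ey) =
    a ℤ.* b , d ℤ.* e , *-≢0 d≢0 e≢0 , (begin
    ofℤ (a ℤ.* b)             ≈⟨ ofℤ-*-homo a b ⟩
    ofℤ a ⊗ ofℤ b             ≈⟨ ⊗-cong a≃dx b≃ey ⟩
    (ofℤ d ⊗ x) ⊗ (ofℤ e ⊗ y) ≈⟨ solve 4 (λ d e x y → (d :* x) :* (e :* y) := (d :* e) :* (x :* y)) ≃-refl (ofℤ d) (ofℤ e) x y ⟩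
    (ofℤ d ⊗ ofℤ e) ⊗ (x ⊗ y) ≈⟨ ⊗-cong (≃-sym (ofℤ-*-homo d e)) ≃-refl ⟩
    ofℤ (d ℤ.* e) ⊗ (x ⊗ y)   ∎)

  isRational-⊖ : ∀ {x} → IsRational x → IsRational (⊖ x)
  isRational-⊖ {x} (a , d , d≢0 , a≃dx) = ℤ.- a , d , d≢0 , (begin
    ofℤ (ℤ.- a)    ≈⟨ ofℤ-neg-homo a ⟩
    ⊖ ofℤ a        ≈⟨ ⊖-cong a≃dx ⟩
    ⊖ (ofℤ d ⊗ x)  ≈⟨ solve 2 (λ d x → :- (d :* x) := d :* (:- x)) ≃-refl (ofℤ d) x ⟩
    ofℤ d ⊗ (⊖ x)  ∎)

  isRational-ofℤ : ∀ n → IsRational (ofℤ n)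
  isRational-ofℤ n = n , + 1 , (λ ()) , solve 1 (λ n → n := con (+ 1) :* n) ≃-refl (ofℤ n)

  isRational-ofℤ[1/p] : ∀ N E → IsRational (ofℤ[1/p] N E)
  isRational-ofℤ[1/p] N E = N , +p^ E , +p^E≢0 , ≈⇒≃ (subst (ofℤ N ≈_) (sym (⊗≡* (ofℤ (+p^ E)) (ofℤ[1/p] N E)))
    (≈-intro-exact {y = ofℤ (+p^ E) * ofℤ[1/p] N E}
      (numApprox-ofℤ N) (numApprox-* (numApprox-ofℤ (+p^ E)) (numApprox (approx-ofℤℤp N))) refl refl
      (λ k → sym (ℤₚ.*-identityˡ (+p^ E ℤ.* N)))))
    where
    +p^E≢0 : +p^ E ≢ + 0
    +p^E≢0 e = ℕ.≢-nonZero⁻¹ (p ℕ.^ E) {{m^n≢0 p E}} (ℤₚ.+-injective e)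

  Rep⇒isRational : ∀ r {z} → Rep r z → IsRational z
  Rep⇒isRational r {z} rep =
    ↥ r , + ↧ₙ r , (λ ()) , ≈⇒≃ (subst (ofℤ (↥ r) ≈_) (sym (⊗≡* (ofℤ (+ ↧ₙ r)) z)) rep)

  -- Rep needs a fraction in lowest terms, obtained by normalising m / (1 + k).
  ofℤ≃suc*⇒Rep : ∀ m k z → ofℤ m ≃ ofℤ (+ suc k) ⊗ z → Σ ℚ λ r → Rep r z
  ofℤ≃suc*⇒Rep m k z m≃[1+k]z with fromℚᵘ (mkℚᵘ m k) | toℚᵘ-fromℚᵘ (mkℚᵘ m k)
  ... | mkℚ a d coprime | *≡* a[1+k]≡m[1+d] =
    mkℚ a d coprime , subst (ofℤ a ≈_) (⊗≡* (ofℤ (+ suc d)) z) (≃⇒≈ (*-cancelˡ-ofℤ≃ n (λ ()) (begin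
      ofℤ n ⊗ ofℤ a                  ≈⟨ ofℤ-*-homo n a ⟨
      ofℤ (n ℤ.* a)                  ≡⟨ cong ofℤ (trans (ℤₚ.*-comm n a) a[1+k]≡m[1+d]) ⟩
      ofℤ (m ℤ.* + suc d)            ≈⟨ ofℤ-*-homo m (+ suc d) ⟩
      ofℤ m ⊗ ofℤ (+ suc d)          ≈⟨ ⊗-cong m≃[1+k]z ≃-refl ⟩
      (ofℤ n ⊗ z) ⊗ ofℤ (+ suc d)    ≈⟨ solve 3 (λ n z d → (n :* z) :* d := n :* (d :* z)) ≃-refl (ofℤ n) z (ofℤ (+ suc d)) ⟩
      ofℤ n ⊗ (ofℤ (+ suc d) ⊗ z)    ∎)))
    where n = + suc k

  isRational⇒Rep : ∀ {z} → IsRational z → Σ ℚ λ r → Rep r z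
  isRational⇒Rep (m , + zero   , d≢0 , _)      = ⊥-elim (d≢0 refl)
  isRational⇒Rep (m , + suc k  , _ , m≃dz)     = ofℤ≃suc*⇒Rep m k _ m≃dz
  isRational⇒Rep {z} (m , -[1+ k ] , _ , m≃dz) = ofℤ≃suc*⇒Rep (ℤ.- m) k z (begin
    ofℤ (ℤ.- m)            ≈⟨ ofℤ-neg-homo m ⟩
    ⊖ ofℤ m                ≈⟨ ⊖-cong m≃dz ⟩
    ⊖ (ofℤ -[1+ k ] ⊗ z)   ≈⟨ solve 2 (λ d z → :- (d :* z) := (:- d) :* z) ≃-refl (ofℤ -[1+ k ]) z ⟩
    (⊖ ofℤ -[1+ k ]) ⊗ z   ≈⟨ ⊗-cong (≃-sym (ofℤ-neg-homo -[1+ k ])) ≃-refl ⟩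
    ofℤ (+ suc k) ⊗ z      ∎)

module QuadraticIrrationals (p : ℕ) {{_ : NonZero p}} (p-prime : Prime p) where
  open Rationals p p-prime public
  open Qp-Solver using (solve; _:=_; _:+_; _:*_; :-_; _:-_; con)
  open ≈-Reasoning ≃-setoid

  module Conjugation (α B C : Qp) (ratB : IsRational B) (ratC : IsRational C)
    (root : α ⊗ α ⊕ B ⊗ α ⊕ C ≃ 0ₚ) (irrational : ¬ IsRational α) where

    conj : Qp
    conj = ⊖ B ⊖ α

    rational-coords-vanish : ∀ {u v} → IsRational u → IsRational v → u ⊕ v ⊗ α ≃ 0ₚ → (u ≃ 0ₚ) × (v ≃ 0ₚ)
    rational-coords-vanish {u} {v} (a , d , d≢0 , a≃du) (b , e , e≢0 , b≃ev) u+vα≃0 with b ℤ.≟ + 0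
    ... | yes refl = u≃0 , v≃0
      where
      v≃0 : v ≃ 0ₚ
      v≃0 = *-cancelˡ-ofℤ≃ e e≢0 (begin
        ofℤ e ⊗ v   ≈⟨ ≃-sym b≃ev ⟩
        0ₚ          ≈⟨ solve 1 (λ e → con (+ 0) := e :* con (+ 0)) ≃-refl (ofℤ e) ⟩
        ofℤ e ⊗ 0ₚ  ∎)
      u≃0 : u ≃ 0ₚ
      u≃0 = begin
        u                   ≈⟨ solve 3 (λ u v α → u := (u :+ v :* α) :- v :* α) ≃-refl u v α ⟩
        (u ⊕ v ⊗ α) ⊖ v ⊗ α ≈⟨ ⊕-cong u+vα≃0 (⊖-cong (⊗-cong v≃0 ≃-refl)) ⟩
        0ₚ ⊖ 0ₚ ⊗ α         ≈⟨ solve 1 (λ α → con (+ 0) :- con (+ 0) :* α := con (+ 0)) ≃-refl α ⟩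
        0ₚ                  ∎
    ... | no b≢0 = ⊥-elim (irrational (ℤ.- (a ℤ.* e) , b ℤ.* d , *-≢0 b≢0 d≢0 , (begin
        ofℤ (ℤ.- (a ℤ.* e))                       ≈⟨ ≃-trans (ofℤ-neg-homo (a ℤ.* e)) (⊖-cong (ofℤ-*-homo a e)) ⟩
        ⊖ (ofℤ a ⊗ ofℤ e)                         ≈⟨ ⊖-cong (⊗-cong a≃du ≃-refl) ⟩
        ⊖ ((ofℤ d ⊗ u) ⊗ ofℤ e)                   ≈⟨ solve 5 (λ d e u v α → :- ((d :* u) :* e) := (e :* v) :* d :* α :- (d :* e) :* (u :+ v :* α))
                                                       ≃-refl (ofℤ d) (ofℤ e) u v α ⟩
        (ofℤ e ⊗ v) ⊗ ofℤ d ⊗ α ⊖ (ofℤ d ⊗ ofℤ e) ⊗ (u ⊕ v ⊗ α)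
          ≈⟨ ⊕-cong (⊗-cong (⊗-cong (≃-sym b≃ev) ≃-refl) ≃-refl) (⊖-cong (⊗-cong ≃-refl u+vα≃0)) ⟩
        ofℤ b ⊗ ofℤ d ⊗ α ⊖ (ofℤ d ⊗ ofℤ e) ⊗ 0ₚ  ≈⟨ solve 4 (λ b d e α → b :* d :* α :- d :* e :* con (+ 0) := b :* d :* α)
                                                       ≃-refl (ofℤ b) (ofℤ d) (ofℤ e) α ⟩
        ofℤ b ⊗ ofℤ d ⊗ α                         ≈⟨ ⊗-cong (≃-sym (ofℤ-*-homo b d)) ≃-refl ⟩
        ofℤ (b ℤ.* d) ⊗ α                         ∎)))

    conj-root : conj ⊗ conj ⊕ B ⊗ conj ⊕ C ≃ 0ₚ
    conj-root = ≃-trans (solve 3 (λ α B C → (:- B :- α) :* (:- B :- α) :+ B :* (:- B :- α) :+ C := α :* α :+ B :* α :+ C)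
                           ≃-refl α B C) root

    -- For t ∈ {α, conj}, (X' + Y' t)(Z + Y t) = u + v t + Y'Y (t² + B t + C) + 1 with u, v rational;
    -- at t = α this forces u = v = 0, and conj is a root of t² + B t + C as well.
    conj-resp-recip : ∀ {X' Y' Z Y} → IsRational X' → IsRational Y' → IsRational Z → IsRational Y →
                      (X' ⊕ Y' ⊗ α) ⊗ (Z ⊕ Y ⊗ α) ≃ 1ₚ → (X' ⊕ Y' ⊗ conj) ⊗ (Z ⊕ Y ⊗ conj) ≃ 1ₚ
    conj-resp-recip {X'} {Y'} {Z} {Y} ratX' ratY' ratZ ratY recip = begin
        (X' ⊕ Y' ⊗ conj) ⊗ (Z ⊕ Y ⊗ conj)                             ≈⟨ expand conj ⟩
        u ⊕ v ⊗ conj ⊕ (Y' ⊗ Y) ⊗ (conj ⊗ conj ⊕ B ⊗ conj ⊕ C) ⊕ 1ₚ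
          ≈⟨ ⊕-cong (⊕-cong (⊕-cong u≃0 (⊗-cong v≃0 ≃-refl)) (⊗-cong ≃-refl conj-root)) ≃-refl ⟩
        0ₚ ⊕ 0ₚ ⊗ conj ⊕ (Y' ⊗ Y) ⊗ 0ₚ ⊕ 1ₚ
          ≈⟨ solve 2 (λ t w → con (+ 0) :+ con (+ 0) :* t :+ w :* con (+ 0) :+ con (+ 1) := con (+ 1)) ≃-refl conj (Y' ⊗ Y) ⟩
        1ₚ                                                           ∎
      where
      u = X' ⊗ Z ⊖ Y' ⊗ Y ⊗ C ⊖ 1ₚ
      v = X' ⊗ Y ⊕ Y' ⊗ Z ⊖ Y' ⊗ Y ⊗ B
      expand : ∀ t → (X' ⊕ Y' ⊗ t) ⊗ (Z ⊕ Y ⊗ t) ≃ u ⊕ v ⊗ t ⊕ (Y' ⊗ Y) ⊗ (t ⊗ t ⊕ B ⊗ t ⊕ C) ⊕ 1ₚ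
      expand = solve 7 (λ X' Y' Z Y B C t →
            (X' :+ Y' :* t) :* (Z :+ Y :* t)
          := (X' :* Z :- Y' :* Y :* C :- con (+ 1)) :+ (X' :* Y :+ Y' :* Z :- Y' :* Y :* B) :* t
              :+ (Y' :* Y) :* (t :* t :+ B :* t :+ C) :+ con (+ 1))
          ≃-refl X' Y' Z Y B C
      ratu : IsRational u
      ratu = isRational-⊕ (isRational-⊕ (isRational-⊗ ratX' ratZ) (isRational-⊖ (isRational-⊗ (isRational-⊗ ratY' ratY) ratC)))
                          (isRational-⊖ (isRational-ofℤ (+ 1)))
      ratv : IsRational v
      ratv = isRational-⊕ (isRational-⊕ (isRational-⊗ ratX' ratY) (isRational-⊗ ratY' ratZ))
                          (isRational-⊖ (isRational-⊗ (isRational-⊗ ratY' ratY) ratB))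
      u+vα≃0 : u ⊕ v ⊗ α ≃ 0ₚ
      u+vα≃0 = begin
        u ⊕ v ⊗ α
          ≈⟨ solve 3 (λ w q s → w := w :+ s :* q :+ con (+ 1) :- s :* q :- con (+ 1))
               ≃-refl (u ⊕ v ⊗ α) (α ⊗ α ⊕ B ⊗ α ⊕ C) (Y' ⊗ Y) ⟩
        u ⊕ v ⊗ α ⊕ (Y' ⊗ Y) ⊗ (α ⊗ α ⊕ B ⊗ α ⊕ C) ⊕ 1ₚ ⊖ (Y' ⊗ Y) ⊗ (α ⊗ α ⊕ B ⊗ α ⊕ C) ⊖ 1ₚ
          ≈⟨ ⊕-cong (⊕-cong (≃-sym (expand α)) ≃-refl) ≃-refl ⟩
        (X' ⊕ Y' ⊗ α) ⊗ (Z ⊕ Y ⊗ α) ⊖ (Y' ⊗ Y) ⊗ (α ⊗ α ⊕ B ⊗ α ⊕ C) ⊖ 1ₚ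
          ≈⟨ ⊕-cong (⊕-cong recip (⊖-cong (⊗-cong ≃-refl root))) ≃-refl ⟩
        1ₚ ⊖ (Y' ⊗ Y) ⊗ 0ₚ ⊖ 1ₚ
          ≈⟨ solve 1 (λ s → con (+ 1) :- s :* con (+ 0) :- con (+ 1) := con (+ 0)) ≃-refl (Y' ⊗ Y) ⟩
        0ₚ                                                            ∎
      u≃0 : u ≃ 0ₚ
      u≃0 = proj₁ (rational-coords-vanish ratu ratv u+vα≃0)
      v≃0 : v ≃ 0ₚ
      v≃0 = proj₂ (rational-coords-vanish ratu ratv u+vα≃0)

  module CompleteQuotients
    (α B C : Qp) (ratB : IsRational B) (ratC : IsRational C)
    (quad : α * α + B * α + C ≈ 0ₚ) (irr : ¬ (Σ ℚ λ r → Rep r α))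
    (negα : NegVal α) (inpαc : InpZp (- B - α))
    (αs a : ℕ → Qp) (rat-a : ∀ n → IsRational (a n)) (α₀ : αs 0 ≈ α)
    (near : ∀ n → InpZp (αs n - a n)) (step : ∀ n → αs (suc n) * (αs n - a n) ≈ 1ₚ)
    (X Y : ℕ → Qp) (ratX : ∀ n → IsRational (X n)) (ratY : ∀ n → IsRational (Y n))
    (coords : ∀ n → αs n ≈ X n + Y n * α) where

    root : α ⊗ α ⊕ B ⊗ α ⊕ C ≃ 0ₚ
    root = ≈⇒≃ (subst (_≈ 0ₚ) (sym (trans (⊕≡+ (α ⊗ α ⊕ B ⊗ α) C)
             (cong (_+ C) (trans (⊕≡+ (α ⊗ α) (B ⊗ α)) (cong₂ _+_ (⊗≡* α α) (⊗≡* B α)))))) quad)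

    open Conjugation α B C ratB ratC root (irr ∘ isRational⇒Rep)

    conj≡ : conj ≡ - B - α
    conj≡ = trans (⊖≡-₂ (⊖ B) α) (cong (_- α) (⊖≡- B))

    αₙ-aₙ≡ : ∀ n → αs n ⊖ a n ≡ αs n - a n
    αₙ-aₙ≡ n = ⊖≡-₂ (αs n) (a n)

    recip : ∀ n → αs (suc n) ⊗ (αs n ⊖ a n) ≃ 1ₚ
    recip n = ≈⇒≃ (subst (_≈ 1ₚ) (sym (trans (⊗≡* (αs (suc n)) (αs n ⊖ a n)) (cong (αs (suc n) *_) (αₙ-aₙ≡ n)))) (step n))

    coords⊕ : ∀ n → αs n ≃ X n ⊕ Y n ⊗ α
    coords⊕ n = ≈⇒≃ (subst (αs n ≈_) (sym (⊕⊗≡+* (X n) (Y n) α)) (coords n))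

    -- c n is the conjugate complete quotient α_nᶜ, and γ n below is -1/α_{n+1}ᶜ.
    c : ℕ → Qp
    c n = X n ⊕ Y n ⊗ conj

    c≡ : ∀ n → c n ≡ X n + Y n * (- B - α)
    c≡ n = trans (⊕⊗≡+* (X n) (Y n) conj) (cong (λ t → X n + Y n * t) conj≡)

    c-recip : ∀ n → c (suc n) ⊗ (c n ⊖ a n) ≃ 1ₚ
    c-recip n = ≃-trans (⊗-cong (≃-refl {c (suc n)}) (shift conj))
      (conj-resp-recip (ratX (suc n)) (ratY (suc n)) (isRational-⊕ (ratX n) (isRational-⊖ (rat-a n))) (ratY n) (begin
        (X (suc n) ⊕ Y (suc n) ⊗ α) ⊗ ((X n ⊖ a n) ⊕ Y n ⊗ α)
          ≈⟨ ⊗-cong (≃-sym (coords⊕ (suc n))) (≃-trans (≃-sym (shift α)) (⊕-cong (≃-sym (coords⊕ n)) ≃-refl)) ⟩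
        αs (suc n) ⊗ (αs n ⊖ a n)  ≈⟨ recip n ⟩
        1ₚ                         ∎))
      where
      shift : ∀ t → X n ⊕ Y n ⊗ t ⊖ a n ≃ (X n ⊖ a n) ⊕ Y n ⊗ t
      shift t = solve 4 (λ x y t a → x :+ y :* t :- a := (x :- a) :+ y :* t) ≃-refl (X n) (Y n) t (a n)

    c₀≃conj : c 0 ≃ conj
    c₀≃conj = begin
      X 0 ⊕ Y 0 ⊗ conj                ≈⟨ solve 3 (λ x y t → x :+ y :* t := x :+ (y :- con (+ 1) :+ con (+ 1)) :* t) ≃-refl (X 0) (Y 0) conj ⟩
      X 0 ⊕ (Y 0 ⊖ 1ₚ ⊕ 1ₚ) ⊗ conj    ≈⟨ ⊕-cong (proj₁ vanish) (⊗-cong (⊕-cong (proj₂ vanish) ≃-refl) ≃-refl) ⟩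
      0ₚ ⊕ (0ₚ ⊕ 1ₚ) ⊗ conj           ≈⟨ solve 1 (λ t → con (+ 0) :+ (con (+ 0) :+ con (+ 1)) :* t := t) ≃-refl conj ⟩
      conj                            ∎
      where
      coords₀ : X 0 ⊕ (Y 0 ⊖ 1ₚ) ⊗ α ≃ 0ₚ
      coords₀ = begin
        X 0 ⊕ (Y 0 ⊖ 1ₚ) ⊗ α  ≈⟨ solve 3 (λ x y α → x :+ (y :- con (+ 1)) :* α := x :+ y :* α :- α) ≃-refl (X 0) (Y 0) α ⟩
        X 0 ⊕ Y 0 ⊗ α ⊖ α     ≈⟨ ⊕-cong (≃-trans (≃-sym (coords⊕ 0)) (≈⇒≃ α₀)) ≃-refl ⟩
        α ⊖ α                 ≈⟨ solve 1 (λ α → α :- α := con (+ 0)) ≃-refl α ⟩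
        0ₚ                    ∎
      vanish : (X 0 ≃ 0ₚ) × (Y 0 ⊖ 1ₚ ≃ 0ₚ)
      vanish = rational-coords-vanish (ratX 0) (isRational-⊕ (ratY 0) (isRational-⊖ (isRational-ofℤ (+ 1)))) coords₀

    valuations : ∀ n → (¬ 0 ≤v αs n) × (1 ≤v c n)
    valuations zero =
      (λ 0≤vα₀ → negα (0≤v⇒InZp α (≤v-resp (≈⇒≃ α₀) 0≤vα₀))) ,
      ≤v-resp (≃-sym c₀≃conj) (subst (1 ≤v_) (sym conj≡) (InpZp⇒1≤v (- B - α) inpαc))
    valuations (suc n) = 0≰vαₙ₊₁ , 1≤vcₙ₊₁
      where
      1≤vαₙ-aₙ : 1 ≤v αs n ⊖ a n
      1≤vαₙ-aₙ = subst (1 ≤v_) (sym (αₙ-aₙ≡ n)) (InpZp⇒1≤v (αs n - a n) (near n))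
      0≰vaₙ : ¬ 0 ≤v a n
      0≰vaₙ 0≤vaₙ = proj₁ (valuations n)
        (≤v-resp (solve 2 (λ x a → x :- a :+ a := x) ≃-refl (αs n) (a n)) (≤v-⊕ (≤v-weaken 1≤vαₙ-aₙ) 0≤vaₙ))
      0≰vcₙ-aₙ : ¬ 0 ≤v c n ⊖ a n
      0≰vcₙ-aₙ 0≤vcₙ-aₙ = 0≰vaₙ
        (≤v-resp (solve 2 (λ c a → c :- (c :- a) := a) ≃-refl (c n) (a n))
          (≤v-⊕ (≤v-weaken (proj₂ (valuations n))) (≤v-⊖ 0≤vcₙ-aₙ)))
      0≰vαₙ₊₁ : ¬ 0 ≤v αs (suc n)
      0≰vαₙ₊₁ 0≤vαₙ₊₁ = 1≰v1ₚ (≤v-resp (recip n) (≤v-⊗ 0≤vαₙ₊₁ 1≤vαₙ-aₙ))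
      -- v(c_{n+1}) = -v(c_n - a_n) > 0.
      1≤vcₙ₊₁ : 1 ≤v c (suc n)
      1≤vcₙ₊₁ = Dec.decidable-stable (≤v? 1 (c (suc n)))
        (λ 1≰vcₙ₊₁ → 1≰v∧0≰v⇒0≰v-⊗ 1≰vcₙ₊₁ 0≰vcₙ-aₙ (≤v-resp (≃-sym (c-recip n)) 0≤v1ₚ))

    γ : ℕ → Qp
    γ n = a n ⊖ c n

    γ-recip : ∀ n → γ n ⊗ c (suc n) ≃ ⊖ 1ₚ
    γ-recip n = ≃-trans (solve 3 (λ a c c' → (a :- c) :* c' := :- (c' :* (c :- a))) ≃-refl (a n) (c n) (c (suc n)))
                        (⊖-cong (c-recip n))

    neg-recip : ∀ {x y} → y ⊗ x ≃ ⊖ 1ₚ → ⊖ x ⊗ y ≃ 1ₚ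
    neg-recip {x} {y} yx≃-1 = begin
      ⊖ x ⊗ y    ≈⟨ solve 2 (λ x y → :- x :* y := :- (y :* x)) ≃-refl x y ⟩
      ⊖ (y ⊗ x)  ≈⟨ ⊖-cong yx≃-1 ⟩
      ⊖ ⊖ 1ₚ     ≈⟨ solve 0 (:- (:- con (+ 1)) := con (+ 1)) ≃-refl ⟩
      1ₚ         ∎

    valuations-of-quotients : ∀ n → NegVal (αs n) × InpZp (X n + Y n * (- B - α))
    valuations-of-quotients n =
      (λ inZ → proj₁ (valuations n) (InZp⇒0≤v (αs n) inZ)) ,
      subst InpZp (c≡ n) (1≤v⇒InpZp (c n) (proj₂ (valuations n)))

    γ-recip-≈ : ∀ n → γ n * (X (suc n) + Y (suc n) * (- B - α)) ≈ - 1ₚ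
    γ-recip-≈ n = subst₂ _≈_ (trans (⊗≡* (γ n) (c (suc n))) (cong (γ n *_) (c≡ (suc n)))) (⊖≡- 1ₚ) (≃⇒≈ (γ-recip n))

    cfEval : ∀ {β} → β * (X 0 + Y 0 * (- B - α)) ≈ - 1ₚ → ∀ n → CFEval (downFrom a n) β (γ n)
    cfEval {β} βc₀≈-1 zero =
      cf-step {δ = β} {w = ⊖ c 0} (cf-base (≈-refl {β})) (⊗≃⇒*≈ (neg-recip βc₀≃-1)) (⊕≈+ (a 0) (⊖ c 0))
      where
      βc₀≃-1 : β ⊗ c 0 ≃ ⊖ 1ₚ
      βc₀≃-1 = ≈⇒≃ (subst₂ _≈_ (sym (trans (⊗≡* β (c 0)) (cong (β *_) (c≡ 0)))) (sym (⊖≡- 1ₚ)) βc₀≈-1)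
    cfEval βc₀≈-1 (suc n) =
      cf-step {δ = γ n} {w = ⊖ c (suc n)} (cfEval βc₀≈-1 n) (⊗≃⇒*≈ (neg-recip (γ-recip n)))
        (⊕≈+ (a (suc n)) (⊖ c (suc n)))

proposition3p1 : (p : ℕ) {{p≢0 : NonZero p}} → Prime p → 2 ℕ.< p →
    let open Padic p in
    (α : Qp) (b c : ℚ) (B C : Qp) → Rep b B → Rep c C →
    α * α + B * α + C ≈ 0ₚ →
    ¬ (Σ ℚ λ r → Rep r α) →
    let αc = - B - α in
    NegVal α → InpZp αc →
    (αs : ℕ → Qp) (N : ℕ → ℤ) (E : ℕ → ℕ) →
    αs 0 ≈ α →
    (∀ n → 2 ℕ.* ∣ N n ∣ ℕ.< p ℕ.^ ℕ.suc (E n)) →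
    (∀ n → InpZp (αs n - ofℤ[1/p] (N n) (E n))) →
    (∀ n → αs (ℕ.suc n) * (αs n - ofℤ[1/p] (N n) (E n)) ≈ 1ₚ) →
    (X Y : ℕ → ℚ) (XQ YQ : ℕ → Qp) →
    (∀ n → Rep (X n) (XQ n)) → (∀ n → Rep (Y n) (YQ n)) →
    (∀ n → αs n ≈ XQ n + YQ n * α) →
    (β : Qp) → β * (XQ 0 + YQ 0 * αc) ≈ - 1ₚ →
    ∀ n →
      (NegVal (αs n) × InpZp (XQ n + YQ n * αc)) ×
      ∃ λ γ → (γ * (XQ (ℕ.suc n) + YQ (ℕ.suc n) * αc) ≈ - 1ₚ) ×
              CFEval (downFrom (λ k → ofℤ[1/p] (N k) (E k)) n) β γ
proposition3p1 p p-prime _ α bℚ cℚ B C repB repC quad irr negα inpαc αs N E α₀ _ near step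
               Xℚ Yℚ X Y repX repY coords β hβ n =
  valuations-of-quotients n , γ n , γ-recip-≈ n , cfEval hβ n
  where
  open QuadraticIrrationals p p-prime
  open CompleteQuotients α B C (Rep⇒isRational bℚ repB) (Rep⇒isRational cℚ repC) quad irr negα inpαc
    αs (λ k → ofℤ[1/p] (N k) (E k)) (λ k → isRational-ofℤ[1/p] (N k) (E k)) α₀ near step X Y
    (λ k → Rep⇒isRational (Xℚ k) (repX k)) (λ k → Rep⇒isRational (Yℚ k) (repY k)) coords
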